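{- Let $a\ge 6$ and $n\ge 1$ be integers and $d_n=\mathrm{lcm}(1,2,\ldots,n)$. Then for every $l\in\{1,\ldots,a\}$, $2d_n^{a-l}P_{l,n}(z)\in\mathbb{Z}[z]$, and $2d_n^{a+2}P_{0,n}(z)\in\mathbb{Z}[z]$.
   Context: $(\alpha)_m=\alpha(\alpha+1)\cdots(\alpha+m-1)$ denotes the Pochhammer symbol. Define $$R_n(t)=n!^{a-6}\left(t+\frac n2\right)\frac{(t-n)_n^3\,(t+n+1)_n^3}{(t)_{n+1}^a},$$ $D_\lambda=\frac{1}{\lambda!}\left(\frac{d}{dt}\right)^\lambda$, and for $l\in\{1,\ldots,a\}$, $j\in\{0,\ldots,n\}$, $c_{l,j,n}=D_{a-l}\big(R_n(t)(t+j)^a\big)\big|_{t=-j}$. Define $$P_{0,n}(z)=-\sum_{l=1}^a\sum_{j=1}^n\sum_{k=1}^{j}\frac{l(l+1)\,c_{l,j,n}}{2k^{l+2}}z^{j-k},\qquad P_{l,n}(z)=\sum_{j=0}^n c_{l,j,n}z^j\quad(1\le l\le a).$$ -}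

module Defs where

open import Data.Nat as ℕ using (ℕ; zero; suc; _∸_)
open import Data.Nat.LCM using (lcm)
open import Data.Integer as ℤ using (ℤ; +_)
open import Data.Rational using (ℚ; 0ℚ; 1ℚ; _+_; _*_; _-_; -_; _÷_; _/_; ≢-nonZero)
open import Data.Rational.Properties using (_≟_)
open import Data.List using (List; []; _∷_; map; foldr; replicate; _++_; upTo; sum)
open import Data.List.Relation.Unary.All using (All)
open import Data.Product using (∃-syntax)
open import Relation.Nullary using (yes; no)
open import Relation.Binary.PropositionalEquality using (_≡_)

fromℕ : ℕ → ℚ
fromℕ k = (+ k) / 1

-- total division (only ever used with a nonzero divisor below)
_÷'_ : ℚ → ℚ → ℚ
p ÷' q with q ≟ 0ℚ
... | yes _  = 0ℚ
... | no q≢0 = _÷_ p q {{≢-nonZero q≢0}}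

_^ℚ_ : ℚ → ℕ → ℚ
q ^ℚ zero  = 1ℚ
q ^ℚ suc k = q * (q ^ℚ k)

IsInt : ℚ → Set
IsInt q = ∃[ k ] q ≡ k / 1

-- Polynomials over ℚ as coefficient lists (lowest degree first)

Poly : Set
Poly = List ℚ

padd : Poly → Poly → Poly
padd []       q        = q
padd p        []       = p
padd (x ∷ p)  (y ∷ q)  = (x + y) ∷ padd p q

pscale : ℚ → Poly → Poly
pscale c = map (c *_)

pmul : Poly → Poly → Poly
pmul []      q = []
pmul (x ∷ p) q = padd (pscale x q) (0ℚ ∷ pmul p q)

pconst : ℚ → Poly
pconst c = c ∷ []

pmonomial : ℚ → ℕ → Poly
pmonomial c e = replicate e 0ℚ ++ (c ∷ [])

plin : ℚ → Poly
plin c = c ∷ 1ℚ ∷ []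

ppow : Poly → ℕ → Poly
ppow p zero    = pconst 1ℚ
ppow p (suc k) = pmul p (ppow p k)

pderiv : Poly → Poly
pderiv []      = []
pderiv (_ ∷ p) = go 1 p
  where
  go : ℕ → Poly → Poly
  go k []      = []
  go k (x ∷ q) = (fromℕ k * x) ∷ go (suc k) q

peval : Poly → ℚ → ℚ
peval p t = foldr (λ c acc → c + t * acc) 0ℚ p

poch : ℚ → ℕ → Poly
poch c zero    = pconst 1ℚ
poch c (suc m) = pmul (poch c m) (plin (c + fromℕ m))

record RatFun : Set where
  constructor _//_
  field
    num : Poly
    den : Poly

rderiv : RatFun → RatFun
rderiv (N // D) = padd (pmul (pderiv N) D) (pscale (- 1ℚ) (pmul N (pderiv D))) // pmul D D

rderivN : ℕ → RatFun → RatFun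
rderivN zero    f = f
rderivN (suc k) f = rderivN k (rderiv f)

reval : RatFun → ℚ → ℚ
reval (N // D) t = peval N t ÷' peval D t

Dλat : ℕ → RatFun → ℚ → ℚ
Dλat λ' f t0 = reval (rderivN λ' f) t0 ÷' fromℕ (λ' ℕ.!)

range0 : ℕ → List ℕ
range0 n = upTo (suc n)

range1 : ℕ → List ℕ
range1 n = map suc (upTo n)

dlcm : ℕ → ℕ
dlcm n = foldr lcm 1 (range1 n)

pprod : List Poly → Poly
pprod = foldr pmul (pconst 1ℚ)

-- the rational function R_n(t) (t+j)^a, with the factor (t+j)^a cancelled
-- against the denominator (t)_{n+1}^a = ∏_{i=0}^n (t+i)^a, i.e.
--   n!^{a-6} (t + n/2) (t-n)_n^3 (t+n+1)_n^3  /  ∏_{0≤i≤n, i≠j} (t+i)^a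
RtimesPow : (a n j : ℕ) → RatFun
RtimesPow a n j = numer // denom
  where
  numer : Poly
  numer = pscale (fromℕ ((n ℕ.!) ℕ.^ (a ∸ 6)))
            (pmul (plin ((+ n) / 2))
              (pmul (ppow (poch (- fromℕ n) n) 3)
                    (ppow (poch (fromℕ (suc n)) n) 3)))
  factor : ℕ → Poly
  factor i with i ℕ.≟ j
  ... | yes _ = pconst 1ℚ
  ... | no _  = ppow (plin (fromℕ i)) a
  denom : Poly
  denom = pprod (map factor (range0 n))

c : (a l j n : ℕ) → ℚ
c a l j n = Dλat (a ∸ l) (RtimesPow a n j) (- fromℕ j)

Pl : (a l n : ℕ) → Poly
Pl a l n = map (λ j → c a l j n) (range0 n)

-- P_{0,n}(z) = - Σ_{l=1}^a Σ_{j=1}^n Σ_{k=1}^j l(l+1) c_{l,j,n} / (2 k^{l+2}) z^{j-k}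
P0 : (a n : ℕ) → Poly
P0 a n = pscale (- 1ℚ)
  (foldr padd []
    (Data.List.concatMap (λ l →
      Data.List.concatMap (λ j →
        map (λ k → pmonomial
                     ((fromℕ (l ℕ.* suc l) * c a l j n)
                       ÷' (fromℕ 2 * (fromℕ k ^ℚ (l ℕ.+ 2))))
                     (j ∸ k))
            (range1 j))
        (range1 n))
      (range1 a)))

InZ[z] : Poly → Set
InZ[z] p = All IsInt p

-- Fix j ≤ n and expand everything at t₀ = -j in the variable X = t + j. With Q = ∏_{i ≤ n, i ≠ j} (t + i),
-- the rational function R_n(t)(t+j)^a equals (t + n/2) (A/Q)³ (B/Q)³ (n!/Q)^{a-6} for A = (t-n)_n and
-- B = (t+n+1)_n, and D_λ of a quotient N/D at t₀ is the X^λ coefficient g_λ of the power series g with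
-- D g = N; so c_{l,j,n} = g_{a-l}. Lagrange interpolation at 0, -1, …, -n gives P/Q = ∑ₖ wₖ X/(k - j + X)
-- for deg P ≤ n, the weights wₖ = P(-k)/∏_{i ≠ k}(i - k) of A, B and n! are integers (up to sign products
-- of binomial coefficients), and the X^m coefficient of X/(k - j + X) has denominator dividing d_n^m since
-- 0 < |k - j| ≤ n. Hence 2 d_n^m g_m ∈ ℤ, which is the claim for P_l; the claim for P_0 follows as k ∣ d_n.

module Submission where

open import Data.Nat using (ℕ; _≤_)
open import Data.Rational using (ℚ)

module Rationals where

  open import Data.Nat as ℕ using (ℕ; zero; suc; _!; _<_; _≤_; _∸_; s≤s)
  import Data.Nat.Properties as ℕ
  open import Data.Integer as ℤ using (ℤ; +_)
  import Data.Integer.Properties as ℤ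
  open import Data.Integer.Solver using () renaming (module +-*-Solver to ℤ-Solver)
  open import Data.Rational.Solver using (module +-*-Solver)
  open import Data.Rational using (ℚ; 0ℚ; 1ℚ; _+_; _*_; -_; _/_; 1/_; toℚᵘ; ≢-nonZero)
  open import Data.Rational.Properties
  import Data.Rational.Unnormalised as ℚᵘ
  import Data.Rational.Unnormalised.Properties as ℚᵘ
  open import Data.Product using (_,_)
  open import Data.Sum using (inj₁; inj₂)
  open import Function using (_∘_)
  open import Relation.Nullary using (¬_; yes; no; contradiction)
  open import Relation.Binary.PropositionalEquality
  open import Defs using (fromℕ; IsInt; _÷'_; _^ℚ_)

  fromℤ : ℤ → ℚ
  fromℤ z = z / 1

  private

    toℚᵘ-fromℤ : ∀ z → toℚᵘ (fromℤ z) ℚᵘ.≃ ℚᵘ.mkℚᵘ z 0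
    toℚᵘ-fromℤ z = toℚᵘ-fromℚᵘ (ℚᵘ.mkℚᵘ z 0)

    ≡-via-ℚᵘ : ∀ {p q : ℚ} {r s} → toℚᵘ p ℚᵘ.≃ r → toℚᵘ q ℚᵘ.≃ s → r ℚᵘ.≃ s → p ≡ q
    ≡-via-ℚᵘ p≃r q≃s r≃s = toℚᵘ-injective (ℚᵘ.≃-trans p≃r (ℚᵘ.≃-trans r≃s (ℚᵘ.≃-sym q≃s)))

  fromℤ-homo-+ : ∀ z w → fromℤ (z ℤ.+ w) ≡ fromℤ z + fromℤ w
  fromℤ-homo-+ z w = ≡-via-ℚᵘ (toℚᵘ-fromℤ (z ℤ.+ w))
    (ℚᵘ.≃-trans (toℚᵘ-homo-+ (fromℤ z) (fromℤ w)) (ℚᵘ.+-cong (toℚᵘ-fromℤ z) (toℚᵘ-fromℤ w)))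
    (ℚᵘ.*≡* (ℤ-Solver.solve 2 (λ x y → (x :+ y) :* con (+ 1) := (x :* con (+ 1) :+ y :* con (+ 1)) :* con (+ 1)) refl z w))
    where open ℤ-Solver

  fromℤ-homo-* : ∀ z w → fromℤ (z ℤ.* w) ≡ fromℤ z * fromℤ w
  fromℤ-homo-* z w = ≡-via-ℚᵘ (toℚᵘ-fromℤ (z ℤ.* w))
    (ℚᵘ.≃-trans (toℚᵘ-homo-* (fromℤ z) (fromℤ w)) (ℚᵘ.*-cong (toℚᵘ-fromℤ z) (toℚᵘ-fromℤ w)))
    (ℚᵘ.*≡* refl)

  fromℤ-homo-neg : ∀ z → fromℤ (ℤ.- z) ≡ - fromℤ z
  fromℤ-homo-neg z = ≡-via-ℚᵘ (toℚᵘ-fromℤ (ℤ.- z))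
    (ℚᵘ.≃-trans (toℚᵘ-homo‿- (fromℤ z)) (ℚᵘ.-‿cong (toℚᵘ-fromℤ z))) ℚᵘ.≃-refl

  fromℤ-injective : ∀ {z w} → fromℤ z ≡ fromℤ w → z ≡ w
  fromℤ-injective {z} {w} eq
    with ℚᵘ.*≡* z*1≡w*1 ← ℚᵘ.≃-trans (ℚᵘ.≃-sym (toℚᵘ-fromℤ z)) (ℚᵘ.≃-trans (toℚᵘ-cong eq) (toℚᵘ-fromℤ w))
    = trans (sym (ℤ.*-identityʳ z)) (trans z*1≡w*1 (ℤ.*-identityʳ w))

  2*[z/2]≡z : ∀ z → fromℤ (+ 2) * (z / 2) ≡ fromℤ z
  2*[z/2]≡z z = ≡-via-ℚᵘ
    (ℚᵘ.≃-trans (toℚᵘ-homo-* (fromℤ (+ 2)) (z / 2)) (ℚᵘ.*-cong (toℚᵘ-fromℤ (+ 2)) (toℚᵘ-fromℚᵘ (ℚᵘ.mkℚᵘ z 1))))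
    (toℚᵘ-fromℤ z)
    (ℚᵘ.*≡* (ℤ-Solver.solve 1 (λ x → (con (+ 2) :* x) :* con (+ 1) := x :* con (+ 2)) refl z))
    where open ℤ-Solver

  fromℕ-homo-+ : ∀ m n → fromℕ (m ℕ.+ n) ≡ fromℕ m + fromℕ n
  fromℕ-homo-+ m n = fromℤ-homo-+ (+ m) (+ n)

  fromℕ-homo-* : ∀ m n → fromℕ (m ℕ.* n) ≡ fromℕ m * fromℕ n
  fromℕ-homo-* m n = trans (cong fromℤ (ℤ.pos-* m n)) (fromℤ-homo-* (+ m) (+ n))

  fromℕ-suc : ∀ n → fromℕ (suc n) ≡ 1ℚ + fromℕ n
  fromℕ-suc = fromℕ-homo-+ 1

  fromℕ-injective : ∀ {m n} → fromℕ m ≡ fromℕ n → m ≡ n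
  fromℕ-injective eq = ℤ.+-injective (fromℤ-injective eq)

  IsInt-fromℤ : ∀ z → IsInt (fromℤ z)
  IsInt-fromℤ z = z , refl

  IsInt-fromℕ : ∀ n → IsInt (fromℕ n)
  IsInt-fromℕ n = IsInt-fromℤ (+ n)

  IsInt-+ : ∀ {p q} → IsInt p → IsInt q → IsInt (p + q)
  IsInt-+ (z , refl) (w , refl) = z ℤ.+ w , sym (fromℤ-homo-+ z w)

  IsInt-* : ∀ {p q} → IsInt p → IsInt q → IsInt (p * q)
  IsInt-* (z , refl) (w , refl) = z ℤ.* w , sym (fromℤ-homo-* z w)

  IsInt-neg : ∀ {p} → IsInt p → IsInt (- p)
  IsInt-neg (z , refl) = ℤ.- z , sym (fromℤ-homo-neg z)

  ÷'-unique : ∀ {p q x} → ¬ q ≡ 0ℚ → p ≡ q * x → p ÷' q ≡ x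
  ÷'-unique {p} {q} {x} q≢0 refl with q ≟ 0ℚ
  ... | yes q≡0 = contradiction q≡0 q≢0
  ... | no q≢0′ = begin
    q * x * 1/ q   ≡⟨ cong (_* 1/ q) (*-comm q x) ⟩
    x * q * 1/ q   ≡⟨ *-assoc x q (1/ q) ⟩
    x * (q * 1/ q) ≡⟨ cong (x *_) (*-inverseʳ q) ⟩
    x * 1ℚ         ≡⟨ *-identityʳ x ⟩
    x              ∎
    where
    open ≡-Reasoning
    instance _ = ≢-nonZero q≢0′

  ÷'-*-cancel : ∀ {q} x → ¬ q ≡ 0ℚ → q * (x ÷' q) ≡ x
  ÷'-*-cancel {q} x q≢0 with q ≟ 0ℚ
  ... | yes q≡0 = contradiction q≡0 q≢0
  ... | no q≢0′ = begin
    q * (x * 1/ q) ≡⟨ *-comm q (x * 1/ q) ⟩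
    x * 1/ q * q   ≡⟨ *-assoc x (1/ q) q ⟩
    x * (1/ q * q) ≡⟨ cong (x *_) (*-inverseˡ q) ⟩
    x * 1ℚ         ≡⟨ *-identityʳ x ⟩
    x              ∎
    where
    open ≡-Reasoning
    instance _ = ≢-nonZero q≢0′

  *-÷'-assoc : ∀ p x q → p * (x ÷' q) ≡ (p * x) ÷' q
  *-÷'-assoc p x q with q ≟ 0ℚ
  ... | yes _ = *-zeroʳ p
  ... | no  _ = sym (*-assoc p x _)

  *-cancelˡ-≡0 : ∀ {q x} → ¬ q ≡ 0ℚ → q * x ≡ 0ℚ → x ≡ 0ℚ
  *-cancelˡ-≡0 {q} {x} q≢0 qx≡0 = begin
    x              ≡⟨ ÷'-unique q≢0 refl ⟨
    (q * x) ÷' q   ≡⟨ cong (_÷' q) qx≡0 ⟩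
    0ℚ ÷' q        ≡⟨ ÷'-unique q≢0 (sym (*-zeroʳ q)) ⟩
    0ℚ             ∎
    where open ≡-Reasoning

  p*q≢0 : ∀ {p q} → ¬ p ≡ 0ℚ → ¬ q ≡ 0ℚ → ¬ p * q ≡ 0ℚ
  p*q≢0 p≢0 q≢0 pq≡0 = q≢0 (*-cancelˡ-≡0 p≢0 pq≡0)

  fromℕ-≢0 : ∀ {n} → ¬ n ≡ 0 → ¬ fromℕ n ≡ 0ℚ
  fromℕ-≢0 n≢0 eq = n≢0 (fromℕ-injective eq)

  fromℕ-!≢0 : ∀ n → ¬ fromℕ (n !) ≡ 0ℚ
  fromℕ-!≢0 n = fromℕ-≢0 (ℕ.≢-nonZero⁻¹ (n !) {{n ℕ.!≢0}})

  ∏ℚ< ∑ℚ< : ℕ → (ℕ → ℚ) → ℚ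
  ∏ℚ< zero    F = 1ℚ
  ∏ℚ< (suc m) F = ∏ℚ< m F * F m
  ∑ℚ< zero    F = 0ℚ
  ∑ℚ< (suc m) F = ∑ℚ< m F + F m

  syntax ∏ℚ< m (λ l → e) = ∏ℚ[ l < m ] e
  syntax ∑ℚ< m (λ l → e) = ∑ℚ[ l < m ] e

  ∏ℚ-cong : ∀ {F G} m → (∀ l → l < m → F l ≡ G l) → ∏ℚ< m F ≡ ∏ℚ< m G
  ∏ℚ-cong zero    F≡G = refl
  ∏ℚ-cong (suc m) F≡G = cong₂ _*_ (∏ℚ-cong m (λ l l<m → F≡G l (ℕ.m≤n⇒m≤1+n l<m))) (F≡G m ℕ.≤-refl)

  ∏ℚ-≡0 : ∀ F {m} i → i < m → F i ≡ 0ℚ → ∏ℚ< m F ≡ 0ℚ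
  ∏ℚ-≡0 F {suc m} i (s≤s i≤m) Fi≡0 with ℕ.m≤n⇒m<n∨m≡n i≤m
  ... | inj₂ refl = trans (cong (∏ℚ< m F *_) Fi≡0) (*-zeroʳ (∏ℚ< m F))
  ... | inj₁ i<m  = trans (cong (_* F m) (∏ℚ-≡0 F i i<m Fi≡0)) (*-zeroˡ (F m))

  ∏ℚ-≢0 : ∀ F m → (∀ l → l < m → ¬ F l ≡ 0ℚ) → ¬ ∏ℚ< m F ≡ 0ℚ
  ∏ℚ-≢0 F zero    F≢0 ()
  ∏ℚ-≢0 F (suc m) F≢0 = p*q≢0 (∏ℚ-≢0 F m (λ l l<m → F≢0 l (ℕ.m≤n⇒m≤1+n l<m))) (F≢0 m ℕ.≤-refl)

  ∑ℚ-single : ∀ F {m} i → i < m → (∀ l → l < m → ¬ l ≡ i → F l ≡ 0ℚ) → ∑ℚ< m F ≡ F i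
  ∑ℚ-single F {suc m} i (s≤s i≤m) F≡0 with ℕ.m≤n⇒m<n∨m≡n i≤m
  ... | inj₂ refl = trans (cong (_+ F i) (∑ℚ-0 i (λ l l<i → F≡0 l (ℕ.m≤n⇒m≤1+n l<i) (ℕ.<⇒≢ l<i)))) (+-identityˡ (F i))
    where
    ∑ℚ-0 : ∀ m → (∀ l → l < m → F l ≡ 0ℚ) → ∑ℚ< m F ≡ 0ℚ
    ∑ℚ-0 zero    _    = refl
    ∑ℚ-0 (suc m) F≡0′ = trans (cong₂ _+_ (∑ℚ-0 m (λ l l<m → F≡0′ l (ℕ.m≤n⇒m≤1+n l<m))) (F≡0′ m ℕ.≤-refl)) (+-identityˡ 0ℚ)
  ... | inj₁ i<m  = trans (cong₂ _+_ (∑ℚ-single F i i<m (λ l l<m → F≡0 l (ℕ.m≤n⇒m≤1+n l<m))) (F≡0 m ℕ.≤-refl (ℕ.<⇒≢ i<m ∘ sym)))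
                          (+-identityʳ (F i))

  fromℕ-sub-≢0 : ∀ {m n} → ¬ m ≡ n → ¬ fromℕ m + - fromℕ n ≡ 0ℚ
  fromℕ-sub-≢0 {m} {n} m≢n m-n≡0 = m≢n (fromℕ-injective (begin
    fromℕ m                      ≡⟨ solve 2 (λ x y → x := x :+ :- y :+ y) refl (fromℕ m) (fromℕ n) ⟩
    fromℕ m + - fromℕ n + fromℕ n ≡⟨ cong (_+ fromℕ n) m-n≡0 ⟩
    0ℚ + fromℕ n                 ≡⟨ +-identityˡ (fromℕ n) ⟩
    fromℕ n                      ∎))
    where
    open ≡-Reasoning
    open +-*-Solver

  fromℕ-∸ : ∀ {m n} → n ≤ m → fromℕ m + - fromℕ n ≡ fromℕ (m ∸ n)
  fromℕ-∸ {m} {n} n≤m = begin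
    fromℕ m + - fromℕ n                     ≡⟨ cong (λ u → fromℕ u + - fromℕ n) (ℕ.m+[n∸m]≡n n≤m) ⟨
    fromℕ (n ℕ.+ (m ∸ n)) + - fromℕ n       ≡⟨ cong (_+ - fromℕ n) (fromℕ-homo-+ n (m ∸ n)) ⟩
    fromℕ n + fromℕ (m ∸ n) + - fromℕ n     ≡⟨ solve 2 (λ a b → a :+ b :+ :- a := b) refl (fromℕ n) (fromℕ (m ∸ n)) ⟩
    fromℕ (m ∸ n)                           ∎
    where
    open ≡-Reasoning
    open +-*-Solver

  fromℕ-∸ˡ : ∀ {m n} → m ≤ n → fromℕ m + - fromℕ n ≡ - fromℕ (n ∸ m)
  fromℕ-∸ˡ {m} {n} m≤n = begin
    fromℕ m + - fromℕ n                     ≡⟨ solve 2 (λ a b → a :+ :- b := :- (b :+ :- a)) refl (fromℕ m) (fromℕ n) ⟩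
    - (fromℕ n + - fromℕ m)                 ≡⟨ cong -_ (fromℕ-∸ m≤n) ⟩
    - fromℕ (n ∸ m)                         ∎
    where
    open ≡-Reasoning
    open +-*-Solver

  IsInt-*÷' : ∀ {s x q z} → ¬ q ≡ 0ℚ → s * x ≡ q * z → IsInt z → IsInt (s * (x ÷' q))
  IsInt-*÷' {s} {x} {q} q≢0 sx≡qz = subst IsInt (sym (trans (*-÷'-assoc s x q) (÷'-unique q≢0 sx≡qz)))

  fromℕ-^ℚ : ∀ m k → fromℕ m ^ℚ k ≡ fromℕ (m ℕ.^ k)
  fromℕ-^ℚ m zero    = refl
  fromℕ-^ℚ m (suc k) = trans (cong (fromℕ m *_) (fromℕ-^ℚ m k)) (sym (fromℕ-homo-* m (m ℕ.^ k)))

module PowerSeries where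

  open import Data.Nat as ℕ using (ℕ; zero; suc; _<_)
  import Data.Nat.Properties as ℕ
  open import Data.Rational using (ℚ; 0ℚ; 1ℚ; _+_; _*_; -_)
  open import Data.Rational.Properties
  open import Data.Rational.Solver using (module +-*-Solver)
  open import Data.Product using (_,_)
  open import Data.Maybe using (nothing)
  open import Algebra.Bundles using (CommutativeRing)
  import Algebra.Solver.Ring.NaturalCoefficients as NaturalCoefficients
  import Relation.Binary.Reasoning.Setoid as SetoidReasoning
  open import Relation.Binary.PropositionalEquality
  open import Defs using (fromℕ)
  open Rationals

  Series : Set
  Series = ℕ → ℚ

  infix  4 _≈_
  infixl 6 _⊕_
  infixl 7 _⊛_ _·_

  _≈_ : Series → Series → Set
  f ≈ g = ∀ k → f k ≡ g k

  _⊕_ : Series → Series → Series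
  (f ⊕ g) k = f k + g k

  ⊖_ : Series → Series
  (⊖ f) k = - f k

  const : ℚ → Series
  const c zero    = c
  const c (suc k) = 0ℚ

  𝟘 𝟙 : Series
  𝟘 _ = 0ℚ
  𝟙 = const 1ℚ

  tail : Series → Series
  tail f k = f (suc k)

  _·_ : ℚ → Series → Series
  (c · f) k = c * f k

  _⊛_ : Series → Series → Series
  (f ⊛ g) zero    = f 0 * g 0
  (f ⊛ g) (suc k) = f 0 * g (suc k) + (tail f ⊛ g) k

  X·_ : Series → Series
  (X· f) zero    = 0ℚ
  (X· f) (suc k) = f k

  X : Series
  X = X· 𝟙

  ≈-refl : ∀ {f} → f ≈ f
  ≈-refl k = refl

  ≈-sym : ∀ {f g} → f ≈ g → g ≈ f
  ≈-sym f≈g k = sym (f≈g k)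

  ≈-trans : ∀ {f g h} → f ≈ g → g ≈ h → f ≈ h
  ≈-trans f≈g g≈h k = trans (f≈g k) (g≈h k)

  ⊕-cong : ∀ {f f′ g g′} → f ≈ f′ → g ≈ g′ → f ⊕ g ≈ f′ ⊕ g′
  ⊕-cong f≈f′ g≈g′ k = cong₂ _+_ (f≈f′ k) (g≈g′ k)

  ⊛-cong : ∀ {f f′ g g′} → f ≈ f′ → g ≈ g′ → f ⊛ g ≈ f′ ⊛ g′
  ⊛-cong f≈f′ g≈g′ zero    = cong₂ _*_ (f≈f′ 0) (g≈g′ 0)
  ⊛-cong f≈f′ g≈g′ (suc k) =
    cong₂ _+_ (cong₂ _*_ (f≈f′ 0) (g≈g′ (suc k))) (⊛-cong (λ m → f≈f′ (suc m)) g≈g′ k)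

  ⊛-congˡ : ∀ f {g g′} → g ≈ g′ → f ⊛ g ≈ f ⊛ g′
  ⊛-congˡ f = ⊛-cong (≈-refl {f})

  ⊛-congʳ : ∀ g {f f′} → f ≈ f′ → f ⊛ g ≈ f′ ⊛ g
  ⊛-congʳ g f≈f′ = ⊛-cong f≈f′ (≈-refl {g})

  ⊕-congˡ : ∀ f {g g′} → g ≈ g′ → f ⊕ g ≈ f ⊕ g′
  ⊕-congˡ f = ⊕-cong (≈-refl {f})

  ⊕-congʳ : ∀ g {f f′} → f ≈ f′ → f ⊕ g ≈ f′ ⊕ g
  ⊕-congʳ g f≈f′ = ⊕-cong f≈f′ (≈-refl {g})

  X·-cong : ∀ {f g} → f ≈ g → X· f ≈ X· g
  X·-cong f≈g zero    = refl
  X·-cong f≈g (suc k) = f≈g k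

  const-cong : ∀ {c d} → c ≡ d → const c ≈ const d
  const-cong refl = ≈-refl

  module _ where
    open +-*-Solver

    ·-⊛ : ∀ c f g → c · f ⊛ g ≈ c · (f ⊛ g)
    ·-⊛ c f g zero    = *-assoc c (f 0) (g 0)
    ·-⊛ c f g (suc k) = begin
      c * f 0 * g (suc k) + (c · tail f ⊛ g) k ≡⟨ cong (c * f 0 * g (suc k) +_) (·-⊛ c (tail f) g k) ⟩
      c * f 0 * g (suc k) + c * (tail f ⊛ g) k ≡⟨ solve 4 (λ c a b d → c :* a :* b :+ c :* d := c :* (a :* b :+ d))
                                                     refl c (f 0) (g (suc k)) ((tail f ⊛ g) k) ⟩
      c * (f 0 * g (suc k) + (tail f ⊛ g) k)   ∎
      where open ≡-Reasoning

    ⊛-distribˡ-⊕ : ∀ f g h → f ⊛ (g ⊕ h) ≈ f ⊛ g ⊕ f ⊛ h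
    ⊛-distribˡ-⊕ f g h zero    = *-distribˡ-+ (f 0) (g 0) (h 0)
    ⊛-distribˡ-⊕ f g h (suc k) = begin
      f 0 * (g (suc k) + h (suc k)) + (tail f ⊛ (g ⊕ h)) k
        ≡⟨ cong (f 0 * (g (suc k) + h (suc k)) +_) (⊛-distribˡ-⊕ (tail f) g h k) ⟩
      f 0 * (g (suc k) + h (suc k)) + ((tail f ⊛ g) k + (tail f ⊛ h) k)
        ≡⟨ solve 5 (λ a b c d e → a :* (b :+ c) :+ (d :+ e) := a :* b :+ d :+ (a :* c :+ e))
             refl (f 0) (g (suc k)) (h (suc k)) ((tail f ⊛ g) k) ((tail f ⊛ h) k) ⟩
      f 0 * g (suc k) + (tail f ⊛ g) k + (f 0 * h (suc k) + (tail f ⊛ h) k) ∎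
      where open ≡-Reasoning

    ⊛-distribʳ-⊕ : ∀ f g h → (g ⊕ h) ⊛ f ≈ g ⊛ f ⊕ h ⊛ f
    ⊛-distribʳ-⊕ f g h zero    = *-distribʳ-+ (f 0) (g 0) (h 0)
    ⊛-distribʳ-⊕ f g h (suc k) = begin
      (g 0 + h 0) * f (suc k) + ((tail g ⊕ tail h) ⊛ f) k
        ≡⟨ cong ((g 0 + h 0) * f (suc k) +_) (⊛-distribʳ-⊕ f (tail g) (tail h) k) ⟩
      (g 0 + h 0) * f (suc k) + ((tail g ⊛ f) k + (tail h ⊛ f) k)
        ≡⟨ solve 5 (λ a b c d e → (b :+ c) :* a :+ (d :+ e) := b :* a :+ d :+ (c :* a :+ e))
             refl (f (suc k)) (g 0) (h 0) ((tail g ⊛ f) k) ((tail h ⊛ f) k) ⟩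
      g 0 * f (suc k) + (tail g ⊛ f) k + (h 0 * f (suc k) + (tail h ⊛ f) k) ∎
      where open ≡-Reasoning

    ⊛-comm : ∀ f g → f ⊛ g ≈ g ⊛ f
    ⊛-comm f g zero          = *-comm (f 0) (g 0)
    ⊛-comm f g (suc zero)    = solve 4 (λ a b c d → a :* b :+ c :* d := d :* c :+ b :* a) refl (f 0) (g 1) (f 1) (g 0)
    ⊛-comm f g (suc (suc k)) = begin
      f 0 * g (2 ℕ.+ k) + (tail f ⊛ g) (suc k)
        ≡⟨ cong (f 0 * g (2 ℕ.+ k) +_) (⊛-comm (tail f) g (suc k)) ⟩
      f 0 * g (2 ℕ.+ k) + (g 0 * f (2 ℕ.+ k) + (tail g ⊛ tail f) k)
        ≡⟨ cong (λ u → f 0 * g (2 ℕ.+ k) + (g 0 * f (2 ℕ.+ k) + u)) (⊛-comm (tail g) (tail f) k) ⟩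
      f 0 * g (2 ℕ.+ k) + (g 0 * f (2 ℕ.+ k) + (tail f ⊛ tail g) k)
        ≡⟨ solve 5 (λ a b c d e → a :* b :+ (c :* d :+ e) := c :* d :+ (a :* b :+ e))
             refl (f 0) (g (2 ℕ.+ k)) (g 0) (f (2 ℕ.+ k)) ((tail f ⊛ tail g) k) ⟩
      g 0 * f (2 ℕ.+ k) + (f 0 * g (2 ℕ.+ k) + (tail f ⊛ tail g) k)
        ≡⟨ cong (g 0 * f (2 ℕ.+ k) +_) (⊛-comm f (tail g) (suc k)) ⟩
      g 0 * f (2 ℕ.+ k) + (tail g ⊛ f) (suc k) ∎
      where open ≡-Reasoning

    ⊛-assoc : ∀ f g h → (f ⊛ g) ⊛ h ≈ f ⊛ (g ⊛ h)
    ⊛-assoc f g h zero    = *-assoc (f 0) (g 0) (h 0)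
    ⊛-assoc f g h (suc k) = begin
      f 0 * g 0 * h (suc k) + (tail (f ⊛ g) ⊛ h) k
        ≡⟨ cong (f 0 * g 0 * h (suc k) +_) (⊛-distribʳ-⊕ h (f 0 · tail g) (tail f ⊛ g) k) ⟩
      f 0 * g 0 * h (suc k) + ((f 0 · tail g ⊛ h) k + ((tail f ⊛ g) ⊛ h) k)
        ≡⟨ cong₂ (λ u v → f 0 * g 0 * h (suc k) + (u + v)) (·-⊛ (f 0) (tail g) h k) (⊛-assoc (tail f) g h k) ⟩
      f 0 * g 0 * h (suc k) + (f 0 * (tail g ⊛ h) k + (tail f ⊛ (g ⊛ h)) k)
        ≡⟨ solve 5 (λ a b c d e → a :* b :* c :+ (a :* d :+ e) := a :* (b :* c :+ d) :+ e)
             refl (f 0) (g 0) (h (suc k)) ((tail g ⊛ h) k) ((tail f ⊛ (g ⊛ h)) k) ⟩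
      f 0 * (g 0 * h (suc k) + (tail g ⊛ h) k) + (tail f ⊛ (g ⊛ h)) k ∎
      where open ≡-Reasoning

  𝟘-⊛ : ∀ f → 𝟘 ⊛ f ≈ 𝟘
  𝟘-⊛ f zero    = *-zeroˡ (f 0)
  𝟘-⊛ f (suc k) = trans (cong₂ _+_ (*-zeroˡ (f (suc k))) (𝟘-⊛ f k)) (+-identityˡ 0ℚ)

  const-⊛ : ∀ c f → const c ⊛ f ≈ c · f
  const-⊛ c f zero    = refl
  const-⊛ c f (suc k) = trans (cong (c * f (suc k) +_) (𝟘-⊛ f k)) (+-identityʳ _)

  𝟙-⊛ : ∀ f → 𝟙 ⊛ f ≈ f
  𝟙-⊛ f k = trans (const-⊛ 1ℚ f k) (*-identityˡ (f k))

  Series-commutativeRing : CommutativeRing _ _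
  Series-commutativeRing = record
    { Carrier = Series
    ; _≈_ = _≈_
    ; _+_ = _⊕_
    ; _*_ = _⊛_
    ; -_ = ⊖_
    ; 0# = 𝟘
    ; 1# = 𝟙
    ; isCommutativeRing = record
      { isRing = record
        { +-isAbelianGroup = record
          { isGroup = record
            { isMonoid = record
              { isSemigroup = record
                { isMagma = record
                  { isEquivalence = record { refl = ≈-refl ; sym = ≈-sym ; trans = ≈-trans }
                  ; ∙-cong = ⊕-cong }
                ; assoc = λ f g h k → +-assoc (f k) (g k) (h k) }
              ; identity = (λ f k → +-identityˡ (f k)) , (λ f k → +-identityʳ (f k)) }
            ; inverse = (λ f k → +-inverseˡ (f k)) , (λ f k → +-inverseʳ (f k))
            ; ⁻¹-cong = λ f≈g k → cong -_ (f≈g k) }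
          ; comm = λ f g k → +-comm (f k) (g k) }
        ; *-cong = ⊛-cong
        ; *-assoc = ⊛-assoc
        ; *-identity = 𝟙-⊛ , (λ f → ≈-trans (⊛-comm f 𝟙) (𝟙-⊛ f))
        ; distrib = ⊛-distribˡ-⊕ , ⊛-distribʳ-⊕ }
      ; *-comm = ⊛-comm } }

  module ⊛-Solver = NaturalCoefficients (CommutativeRing.commutativeSemiring Series-commutativeRing) (λ _ _ → nothing)
  module ≈-Reasoning = SetoidReasoning (CommutativeRing.setoid Series-commutativeRing)

  open import Algebra.Properties.CommutativeSemiring.Exp (CommutativeRing.commutativeSemiring Series-commutativeRing) public
    using (^-congˡ; ^-congʳ; ^-homo-*; ^-distrib-*) renaming (_^_ to _^ₛ_)

  ⊛-𝟘 : ∀ f → f ⊛ 𝟘 ≈ 𝟘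
  ⊛-𝟘 f = ≈-trans (⊛-comm f 𝟘) (𝟘-⊛ f)

  𝟘-⊕ : ∀ f → 𝟘 ⊕ f ≈ f
  𝟘-⊕ f k = +-identityˡ (f k)

  ⊕-𝟘 : ∀ f → f ⊕ 𝟘 ≈ f
  ⊕-𝟘 f k = +-identityʳ (f k)

  ⊕-≈𝟘 : ∀ f {g} → g ≈ 𝟘 → f ⊕ g ≈ f
  ⊕-≈𝟘 f g≈𝟘 = ≈-trans (⊕-congˡ f g≈𝟘) (⊕-𝟘 f)

  ≈𝟘-⊛ : ∀ {f} g → f ≈ 𝟘 → f ⊛ g ≈ 𝟘
  ≈𝟘-⊛ g f≈𝟘 = ≈-trans (⊛-congʳ g f≈𝟘) (𝟘-⊛ g)

  𝟘≈const0 : 𝟘 ≈ const 0ℚ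
  𝟘≈const0 zero    = refl
  𝟘≈const0 (suc k) = refl

  const-+ : ∀ a b → const (a + b) ≈ const a ⊕ const b
  const-+ a b zero    = refl
  const-+ a b (suc k) = sym (+-identityˡ 0ℚ)

  const-* : ∀ a b → const (a * b) ≈ const a ⊛ const b
  const-* a b = ≈-trans a·b (≈-sym (const-⊛ a (const b)))
    where
    a·b : const (a * b) ≈ a · const b
    a·b zero    = refl
    a·b (suc k) = sym (*-zeroʳ a)

  const-inverseˡ : ∀ c → const (- c) ⊕ const c ≈ 𝟘
  const-inverseˡ c zero    = +-inverseˡ c
  const-inverseˡ c (suc k) = +-identityˡ 0ℚ

  const-^ : ∀ m k → const (fromℕ m) ^ₛ k ≈ const (fromℕ (m ℕ.^ k))
  const-^ m zero    = ≈-refl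
  const-^ m (suc k) = begin
    const (fromℕ m) ⊛ const (fromℕ m) ^ₛ k    ≈⟨ ⊛-congˡ (const (fromℕ m)) (const-^ m k) ⟩
    const (fromℕ m) ⊛ const (fromℕ (m ℕ.^ k)) ≈⟨ const-* (fromℕ m) (fromℕ (m ℕ.^ k)) ⟨
    const (fromℕ m * fromℕ (m ℕ.^ k))         ≈⟨ const-cong (fromℕ-homo-* m (m ℕ.^ k)) ⟨
    const (fromℕ (m ℕ.^ suc k))               ∎
    where open ≈-Reasoning

  ⊛-X· : ∀ f g → f ⊛ X· g ≈ X· (f ⊛ g)
  ⊛-X· f g zero          = *-zeroʳ (f 0)
  ⊛-X· f g (suc zero)    = trans (cong (f 0 * g 0 +_) (*-zeroʳ (f 1))) (+-identityʳ _)
  ⊛-X· f g (suc (suc k)) = cong (f 0 * g (suc k) +_) (⊛-X· (tail f) g (suc k))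

  X-⊛ : ∀ f → X ⊛ f ≈ X· f
  X-⊛ f = ≈-trans (⊛-comm X f) (≈-trans (⊛-X· f 𝟙) (X·-cong (≈-trans (⊛-comm f 𝟙) (𝟙-⊛ f))))

  ∏< ∑< : ℕ → (ℕ → Series) → Series
  ∏< zero    F = 𝟙
  ∏< (suc m) F = ∏< m F ⊛ F m
  ∑< zero    F = 𝟘
  ∑< (suc m) F = ∑< m F ⊕ F m

  syntax ∏< m (λ l → e) = ∏[ l < m ] e
  syntax ∑< m (λ l → e) = ∑[ l < m ] e

  ∏-cong : ∀ {F G} m → (∀ l → l < m → F l ≈ G l) → ∏< m F ≈ ∏< m G
  ∏-cong zero    F≈G = ≈-refl
  ∏-cong (suc m) F≈G = ⊛-cong (∏-cong m (λ l l<m → F≈G l (ℕ.m≤n⇒m≤1+n l<m))) (F≈G m ℕ.≤-refl)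

  ∑-cong : ∀ {F G} m → (∀ l → l < m → F l ≈ G l) → ∑< m F ≈ ∑< m G
  ∑-cong zero    F≈G = ≈-refl
  ∑-cong (suc m) F≈G = ⊕-cong (∑-cong m (λ l l<m → F≈G l (ℕ.m≤n⇒m≤1+n l<m))) (F≈G m ℕ.≤-refl)

  ∏-+ : ∀ F m₁ m₂ → ∏< (m₁ ℕ.+ m₂) F ≈ ∏< m₁ F ⊛ ∏[ l < m₂ ] F (m₁ ℕ.+ l)
  ∏-+ F m₁ zero    rewrite ℕ.+-identityʳ m₁ = ≈-sym (≈-trans (⊛-comm (∏< m₁ F) 𝟙) (𝟙-⊛ (∏< m₁ F)))
  ∏-+ F m₁ (suc m) rewrite ℕ.+-suc m₁ m =
    ≈-trans (⊛-congʳ (F (m₁ ℕ.+ m)) (∏-+ F m₁ m)) (⊛-assoc (∏< m₁ F) (∏[ l < m ] F (m₁ ℕ.+ l)) (F (m₁ ℕ.+ m)))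

  ∏-suc : ∀ F m → ∏< (suc m) F ≈ F 0 ⊛ ∏[ l < m ] F (suc l)
  ∏-suc F m = ≈-trans (∏-+ F 1 m) (⊛-congʳ (∏[ l < m ] F (suc l)) (𝟙-⊛ (F 0)))

  ∏-⊛ : ∀ F G m → ∏[ l < m ] (F l ⊛ G l) ≈ ∏< m F ⊛ ∏< m G
  ∏-⊛ F G zero    = ≈-sym (𝟙-⊛ 𝟙)
  ∏-⊛ F G (suc m) = ≈-trans (⊛-congʳ (F m ⊛ G m) (∏-⊛ F G m))
    (solve 4 (λ a b c d → a :* b :* (c :* d) := a :* c :* (b :* d)) ≈-refl (∏< m F) (∏< m G) (F m) (G m))
    where open ⊛-Solver

  ∏-^ : ∀ F a m → ∏[ l < m ] (F l ^ₛ a) ≈ ∏< m F ^ₛ a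
  ∏-^ F zero    m = ∏-𝟙 m
    where
    ∏-𝟙 : ∀ m → ∏[ l < m ] 𝟙 ≈ 𝟙
    ∏-𝟙 zero    = ≈-refl
    ∏-𝟙 (suc m) = ≈-trans (⊛-congʳ 𝟙 (∏-𝟙 m)) (𝟙-⊛ 𝟙)
  ∏-^ F (suc a) m = ≈-trans (∏-⊛ F (λ l → F l ^ₛ a) m) (⊛-congˡ (∏< m F) (∏-^ F a m))

  ⊛-∑ : ∀ f F m → f ⊛ ∑< m F ≈ ∑[ l < m ] (f ⊛ F l)
  ⊛-∑ f F zero    = ⊛-𝟘 f
  ⊛-∑ f F (suc m) = ≈-trans (⊛-distribˡ-⊕ f (∑< m F) (F m)) (⊕-congʳ (f ⊛ F m) (⊛-∑ f F m))

  ∏-0 : ∀ F m → ∏< m F 0 ≡ ∏ℚ[ l < m ] F l 0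
  ∏-0 F zero    = refl
  ∏-0 F (suc m) = cong (_* F m 0) (∏-0 F m)

module SeriesDerivative where

  open import Data.Nat using (zero; suc)
  open import Data.Rational using (ℚ; 0ℚ; 1ℚ; _+_; _*_)
  open import Data.Rational.Properties
  open import Data.Rational.Solver using (module +-*-Solver)
  open import Relation.Binary.PropositionalEquality
  open import Defs using (fromℕ)
  open Rationals
  open PowerSeries
  open +-*-Solver

  -- θ is the Euler operator X d/dX and ∂ = tail ∘ θ; the Leibniz rule is proved for θ,
  -- where it follows by induction along the Cauchy product.
  θ : Series → Series
  θ f k = fromℕ k * f k

  ∂ : Series → Series
  ∂ f k = fromℕ (suc k) * f (suc k)

  private
    tail-θ : ∀ f → tail (θ f) ≈ θ (tail f) ⊕ tail f
    tail-θ f k = begin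
      fromℕ (suc k) * f (suc k)  ≡⟨ cong (_* f (suc k)) (fromℕ-suc k) ⟩
      (1ℚ + fromℕ k) * f (suc k) ≡⟨ solve 2 (λ a b → (con 1ℚ :+ a) :* b := a :* b :+ b) refl (fromℕ k) (f (suc k)) ⟩
      fromℕ k * f (suc k) + f (suc k) ∎
      where open ≡-Reasoning

    θ-⊛ : ∀ f g → θ (f ⊛ g) ≈ θ f ⊛ g ⊕ f ⊛ θ g
    θ-⊛ f g zero    = solve 2 (λ a b → con 0ℚ :* (a :* b) := con 0ℚ :* a :* b :+ a :* (con 0ℚ :* b)) refl (f 0) (g 0)
    θ-⊛ f g (suc k) = begin
      fromℕ (suc k) * (f 0 * g (suc k) + B)
        ≡⟨ cong (_* (f 0 * g (suc k) + B)) (fromℕ-suc k) ⟩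
      (1ℚ + fromℕ k) * (f 0 * g (suc k) + B)
        ≡⟨ solve 4 (λ k f₀ g₁ b → (con 1ℚ :+ k) :* (f₀ :* g₁ :+ b)
                                  := con 0ℚ :* f₀ :* g₁ :+ (k :* b :+ b) :+ f₀ :* ((con 1ℚ :+ k) :* g₁))
             refl (fromℕ k) (f 0) (g (suc k)) B ⟩
      0ℚ * f 0 * g (suc k) + (fromℕ k * B + B) + f 0 * ((1ℚ + fromℕ k) * g (suc k))
        ≡⟨ cong₂ (λ u v → 0ℚ * f 0 * g (suc k) + (u + B) + f 0 * (v * g (suc k))) (θ-⊛ (tail f) g k) (sym (fromℕ-suc k)) ⟩
      0ℚ * f 0 * g (suc k) + (A + C + B) + f 0 * θ g (suc k)
        ≡⟨ solve 5 (λ z a b c d → z :+ (a :+ c :+ b) :+ d := z :+ (a :+ b) :+ (d :+ c))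
             refl (0ℚ * f 0 * g (suc k)) A B C (f 0 * θ g (suc k)) ⟩
      0ℚ * f 0 * g (suc k) + (A + B) + (f 0 * θ g (suc k) + C)
        ≡⟨ cong (λ u → 0ℚ * f 0 * g (suc k) + u + (f 0 * θ g (suc k) + C))
             (sym (trans (⊛-congʳ g (tail-θ f) k) (⊛-distribʳ-⊕ g (θ (tail f)) (tail f) k))) ⟩
      0ℚ * f 0 * g (suc k) + (tail (θ f) ⊛ g) k + (f 0 * θ g (suc k) + C) ∎
      where
      open ≡-Reasoning
      A : ℚ
      A = (θ (tail f) ⊛ g) k
      B : ℚ
      B = (tail f ⊛ g) k
      C : ℚ
      C = (tail f ⊛ θ g) k

    tail-θ-⊛ : ∀ f g → tail (θ f ⊛ g) ≈ ∂ f ⊛ g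
    tail-θ-⊛ f g k = begin
      fromℕ 0 * f 0 * g (suc k) + (∂ f ⊛ g) k ≡⟨ cong (λ u → u * g (suc k) + (∂ f ⊛ g) k) (*-zeroˡ (f 0)) ⟩
      0ℚ * g (suc k) + (∂ f ⊛ g) k            ≡⟨ cong (_+ (∂ f ⊛ g) k) (*-zeroˡ (g (suc k))) ⟩
      0ℚ + (∂ f ⊛ g) k                        ≡⟨ +-identityˡ _ ⟩
      (∂ f ⊛ g) k                             ∎
      where open ≡-Reasoning

  ∂-⊛ : ∀ f g → ∂ (f ⊛ g) ≈ ∂ f ⊛ g ⊕ f ⊛ ∂ g
  ∂-⊛ f g k = begin
    θ (f ⊛ g) (suc k)                     ≡⟨ θ-⊛ f g (suc k) ⟩
    (θ f ⊛ g) (suc k) + (f ⊛ θ g) (suc k) ≡⟨ cong₂ _+_ (tail-θ-⊛ f g k) (⊛-comm f (θ g) (suc k)) ⟩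
    (∂ f ⊛ g) k + (θ g ⊛ f) (suc k)       ≡⟨ cong ((∂ f ⊛ g) k +_) (tail-θ-⊛ g f k) ⟩
    (∂ f ⊛ g) k + (∂ g ⊛ f) k             ≡⟨ cong ((∂ f ⊛ g) k +_) (⊛-comm (∂ g) f k) ⟩
    (∂ f ⊛ g) k + (f ⊛ ∂ g) k             ∎
    where open ≡-Reasoning

  ∂-cong : ∀ {f g} → f ≈ g → ∂ f ≈ ∂ g
  ∂-cong f≈g k = cong (fromℕ (suc k) *_) (f≈g (suc k))

  ∂-⊕ : ∀ f g → ∂ (f ⊕ g) ≈ ∂ f ⊕ ∂ g
  ∂-⊕ f g k = *-distribˡ-+ (fromℕ (suc k)) (f (suc k)) (g (suc k))

  ∂-const : ∀ c → ∂ (const c) ≈ 𝟘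
  ∂-const c k = *-zeroʳ (fromℕ (suc k))

  ∂-𝟘 : ∂ 𝟘 ≈ 𝟘
  ∂-𝟘 k = *-zeroʳ (fromℕ (suc k))

module IntegralSeries where

  open import Data.Nat as ℕ using (ℕ; zero; suc; _<_; _^_)
  import Data.Nat.Properties as ℕ
  open import Data.Rational using (ℚ; 0ℚ; 1ℚ; _+_; _*_; -_)
  open import Data.Rational.Properties
  open import Data.Rational.Solver using (module +-*-Solver)
  open import Relation.Nullary using (¬_)
  open import Relation.Binary.PropositionalEquality
  open import Defs using (fromℕ; IsInt; _÷'_)
  open Rationals
  open PowerSeries
  open +-*-Solver

  DIntegral : ℕ → Series → Set
  DIntegral d f = ∀ m → IsInt (fromℕ (d ^ m) * f m)

  module _ {d : ℕ} where

    DIntegral-cong : ∀ {f g} → f ≈ g → DIntegral d f → DIntegral d g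
    DIntegral-cong f≈g f-int m = subst IsInt (cong (fromℕ (d ^ m) *_) (f≈g m)) (f-int m)

    DIntegral-⊕ : ∀ {f g} → DIntegral d f → DIntegral d g → DIntegral d (f ⊕ g)
    DIntegral-⊕ {f} {g} f-int g-int m =
      subst IsInt (sym (*-distribˡ-+ (fromℕ (d ^ m)) (f m) (g m))) (IsInt-+ (f-int m) (g-int m))

    DIntegral-· : ∀ {c f} → IsInt c → DIntegral d f → DIntegral d (c · f)
    DIntegral-· {c} {f} c-int f-int m =
      subst IsInt (solve 3 (λ a b e → b :* (a :* e) := a :* (b :* e)) refl (fromℕ (d ^ m)) c (f m)) (IsInt-* c-int (f-int m))

    DIntegral-const : ∀ {c} → IsInt c → DIntegral d (const c)
    DIntegral-const c-int zero    = subst IsInt (sym (*-identityˡ _)) c-int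
    DIntegral-const c-int (suc m) = subst IsInt (sym (*-zeroʳ (fromℕ (d ^ suc m)))) (IsInt-fromℕ 0)

    DIntegral-𝟘 : DIntegral d 𝟘
    DIntegral-𝟘 m = subst IsInt (sym (*-zeroʳ (fromℕ (d ^ m)))) (IsInt-fromℕ 0)

    DIntegral-𝟙 : DIntegral d 𝟙
    DIntegral-𝟙 = DIntegral-const (IsInt-fromℕ 1)

    private
      DIntegral-tail : ∀ {f} → DIntegral d f → DIntegral d (fromℕ d · tail f)
      DIntegral-tail {f} f-int m = subst IsInt (begin
        fromℕ (d ^ suc m) * f (suc m)         ≡⟨ cong (_* f (suc m)) (fromℕ-homo-* d (d ^ m)) ⟩
        fromℕ d * fromℕ (d ^ m) * f (suc m)   ≡⟨ solve 3 (λ a b e → a :* b :* e := b :* (a :* e)) refl (fromℕ d) (fromℕ (d ^ m)) (f (suc m)) ⟩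
        fromℕ (d ^ m) * (fromℕ d * f (suc m)) ∎) (f-int (suc m))
        where open ≡-Reasoning

    -- The induction on m goes through because the tail of f is d-integral once scaled by d.
    DIntegral-⊛ : ∀ {f g} → DIntegral d f → DIntegral d g → DIntegral d (f ⊛ g)
    DIntegral-⊛ {f} {g} f-int g-int zero =
      subst IsInt (solve 2 (λ a b → (con 1ℚ :* a) :* (con 1ℚ :* b) := con 1ℚ :* (a :* b)) refl (f 0) (g 0))
        (IsInt-* (f-int 0) (g-int 0))
    DIntegral-⊛ {f} {g} f-int g-int (suc m) =
      subst IsInt eq (IsInt-+ (IsInt-* (f-int 0) (g-int (suc m))) (DIntegral-⊛ (DIntegral-tail f-int) g-int m))
      where
      open ≡-Reasoning
      dᵐ : ℚ
      dᵐ = fromℕ (d ^ m)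
      eq : 1ℚ * f 0 * (fromℕ (d ^ suc m) * g (suc m)) + dᵐ * (fromℕ d · tail f ⊛ g) m
         ≡ fromℕ (d ^ suc m) * (f 0 * g (suc m) + (tail f ⊛ g) m)
      eq = begin
        1ℚ * f 0 * (fromℕ (d ^ suc m) * g (suc m)) + dᵐ * (fromℕ d · tail f ⊛ g) m
          ≡⟨ cong₂ (λ u v → 1ℚ * f 0 * (u * g (suc m)) + dᵐ * v) (fromℕ-homo-* d (d ^ m)) (·-⊛ (fromℕ d) (tail f) g m) ⟩
        1ℚ * f 0 * (fromℕ d * dᵐ * g (suc m)) + dᵐ * (fromℕ d * (tail f ⊛ g) m)
          ≡⟨ solve 5 (λ a b c e h → con 1ℚ :* a :* (b :* c :* e) :+ c :* (b :* h) := b :* c :* (a :* e :+ h))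
               refl (f 0) (fromℕ d) dᵐ (g (suc m)) ((tail f ⊛ g) m) ⟩
        fromℕ d * dᵐ * (f 0 * g (suc m) + (tail f ⊛ g) m)
          ≡⟨ cong (_* (f 0 * g (suc m) + (tail f ⊛ g) m)) (fromℕ-homo-* d (d ^ m)) ⟨
        fromℕ (d ^ suc m) * (f 0 * g (suc m) + (tail f ⊛ g) m) ∎

    DIntegral-^ₛ : ∀ {f} k → DIntegral d f → DIntegral d (f ^ₛ k)
    DIntegral-^ₛ zero    f-int = DIntegral-𝟙
    DIntegral-^ₛ (suc k) f-int = DIntegral-⊛ f-int (DIntegral-^ₛ k f-int)

    DIntegral-∑ : ∀ {F} m → (∀ l → l < m → DIntegral d (F l)) → DIntegral d (∑< m F)
    DIntegral-∑ zero    F-int = DIntegral-𝟘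
    DIntegral-∑ (suc m) F-int =
      DIntegral-⊕ (DIntegral-∑ m (λ l l<m → F-int l (ℕ.m≤n⇒m≤1+n l<m))) (F-int m ℕ.≤-refl)

    DIntegral-X· : ∀ {f} → DIntegral d (fromℕ d · f) → DIntegral d (X· f)
    DIntegral-X· F zero    = subst IsInt (sym (*-zeroʳ 1ℚ)) (IsInt-fromℕ 0)
    DIntegral-X· {f} F (suc m) = subst IsInt (begin
      fromℕ (d ^ m) * (fromℕ d * f m) ≡⟨ solve 3 (λ a b e → a :* (b :* e) := b :* a :* e) refl (fromℕ (d ^ m)) (fromℕ d) (f m) ⟩
      fromℕ d * fromℕ (d ^ m) * f m   ≡⟨ cong (_* f m) (fromℕ-homo-* d (d ^ m)) ⟨
      fromℕ (d ^ suc m) * f m         ∎) (F m)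
      where open ≡-Reasoning

    DIntegral-X : DIntegral d X
    DIntegral-X = DIntegral-X· (DIntegral-· (IsInt-fromℕ d) DIntegral-𝟙)

  invLinear : ℚ → Series
  invLinear r zero    = 1ℚ ÷' r
  invLinear r (suc m) = (- invLinear r m) ÷' r

  invLinear-inverse : ∀ {r} → ¬ r ≡ 0ℚ → (const r ⊕ X) ⊛ invLinear r ≈ 𝟙
  invLinear-inverse {r} r≢0 zero    = trans (cong (_* invLinear r 0) (+-identityʳ r)) (÷'-*-cancel 1ℚ r≢0)
  invLinear-inverse {r} r≢0 (suc m) = begin
    (r + 0ℚ) * invLinear r (suc m) + (tail (const r ⊕ X) ⊛ invLinear r) m
      ≡⟨ cong₂ _+_ (cong (_* invLinear r (suc m)) (+-identityʳ r)) (trans (⊛-congʳ (invLinear r) tail≈𝟙 m) (𝟙-⊛ (invLinear r) m)) ⟩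
    r * ((- invLinear r m) ÷' r) + invLinear r m
      ≡⟨ cong (_+ invLinear r m) (÷'-*-cancel (- invLinear r m) r≢0) ⟩
    - invLinear r m + invLinear r m
      ≡⟨ +-inverseˡ (invLinear r m) ⟩
    0ℚ ∎
    where
    open ≡-Reasoning
    tail≈𝟙 : tail (const r ⊕ X) ≈ 𝟙
    tail≈𝟙 k = +-identityˡ (𝟙 k)

  DIntegral-X·invLinear : ∀ {d r q} → ¬ r ≡ 0ℚ → IsInt q → fromℕ d ≡ q * r → DIntegral d (X· invLinear r)
  DIntegral-X·invLinear {d} {r} {q} r≢0 q-int d≡qr = DIntegral-X· scaled
    where
    open ≡-Reasoning
    d÷r : ∀ x → fromℕ d * (x ÷' r) ≡ q * x
    d÷r x = begin
      fromℕ d * (x ÷' r) ≡⟨ cong (_* (x ÷' r)) d≡qr ⟩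
      q * r * (x ÷' r)   ≡⟨ *-assoc q r (x ÷' r) ⟩
      q * (r * (x ÷' r)) ≡⟨ cong (q *_) (÷'-*-cancel x r≢0) ⟩
      q * x              ∎
    scaled : DIntegral d (fromℕ d · invLinear r)
    scaled zero    = subst IsInt (sym (trans (*-identityˡ _) (trans (d÷r 1ℚ) (*-identityʳ q)))) q-int
    scaled (suc m) = subst IsInt (begin
      - q * (fromℕ (d ^ m) * (fromℕ d * invLinear r m))
        ≡⟨ solve 4 (λ a b c e → (:- a) :* (b :* (c :* e)) := c :* b :* (a :* (:- e))) refl q (fromℕ (d ^ m)) (fromℕ d) (invLinear r m) ⟩
      fromℕ d * fromℕ (d ^ m) * (q * - invLinear r m)
        ≡⟨ cong₂ _*_ (fromℕ-homo-* d (d ^ m)) (d÷r (- invLinear r m)) ⟨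
      fromℕ (d ^ suc m) * (fromℕ d * ((- invLinear r m) ÷' r)) ∎)
      (IsInt-* (IsInt-neg q-int) (scaled m))

module Taylor (t₀ : ℚ) where

  open import Data.Nat using (ℕ; zero; suc)
  open import Data.Rational using (0ℚ; 1ℚ; _+_; _*_)
  open import Data.Rational.Properties
  open import Data.List using ([]; _∷_; map; applyUpTo)
  open import Relation.Binary.PropositionalEquality
  open import Defs
  open Rationals
  open PowerSeries
  open SeriesDerivative

  t₀+X : Series
  t₀+X zero          = t₀
  t₀+X (suc zero)    = 1ℚ
  t₀+X (suc (suc k)) = 0ℚ

  -- The coefficients of p(t₀ + X).
  taylor : Poly → Series
  taylor []      = 𝟘
  taylor (c ∷ p) = const c ⊕ t₀+X ⊛ taylor p

  taylor-0 : ∀ p → taylor p 0 ≡ peval p t₀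
  taylor-0 []      = refl
  taylor-0 (c ∷ p) = cong (λ u → c + t₀ * u) (taylor-0 p)

  taylor-padd : ∀ p q → taylor (padd p q) ≈ taylor p ⊕ taylor q
  taylor-padd []      q       k = sym (+-identityˡ (taylor q k))
  taylor-padd (x ∷ p) []      k = sym (+-identityʳ (taylor (x ∷ p) k))
  taylor-padd (x ∷ p) (y ∷ q) = begin
    const (x + y) ⊕ t₀+X ⊛ taylor (padd p q)
      ≈⟨ ⊕-cong (const-+ x y) (≈-trans (⊛-congˡ t₀+X (taylor-padd p q)) (⊛-distribˡ-⊕ t₀+X (taylor p) (taylor q))) ⟩
    const x ⊕ const y ⊕ (t₀+X ⊛ taylor p ⊕ t₀+X ⊛ taylor q)
      ≈⟨ solve 4 (λ a b c d → a :+ b :+ (c :+ d) := a :+ c :+ (b :+ d)) ≈-refl (const x) (const y) (t₀+X ⊛ taylor p) (t₀+X ⊛ taylor q) ⟩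
    const x ⊕ t₀+X ⊛ taylor p ⊕ (const y ⊕ t₀+X ⊛ taylor q) ∎
    where
    open ≈-Reasoning
    open ⊛-Solver

  taylor-pscale : ∀ c p → taylor (pscale c p) ≈ const c ⊛ taylor p
  taylor-pscale c []      = ≈-sym (⊛-𝟘 (const c))
  taylor-pscale c (x ∷ p) = ≈-trans (⊕-cong (const-* c x) (⊛-congˡ t₀+X (taylor-pscale c p)))
    (solve 4 (λ C X L P → C :* X :+ L :* (C :* P) := C :* (X :+ L :* P)) ≈-refl (const c) (const x) t₀+X (taylor p))
    where open ⊛-Solver

  taylor-pmul : ∀ p q → taylor (pmul p q) ≈ taylor p ⊛ taylor q
  taylor-pmul []      q = ≈-sym (𝟘-⊛ (taylor q))
  taylor-pmul (x ∷ p) q = begin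
    taylor (padd (pscale x q) (0ℚ ∷ pmul p q))
      ≈⟨ taylor-padd (pscale x q) (0ℚ ∷ pmul p q) ⟩
    taylor (pscale x q) ⊕ (const 0ℚ ⊕ t₀+X ⊛ taylor (pmul p q))
      ≈⟨ ⊕-cong (taylor-pscale x q) (⊕-cong (≈-sym 𝟘≈const0) (⊛-congˡ t₀+X (taylor-pmul p q))) ⟩
    const x ⊛ taylor q ⊕ (𝟘 ⊕ t₀+X ⊛ (taylor p ⊛ taylor q))
      ≈⟨ ⊕-congˡ (const x ⊛ taylor q) (𝟘-⊕ (t₀+X ⊛ (taylor p ⊛ taylor q))) ⟩
    const x ⊛ taylor q ⊕ t₀+X ⊛ (taylor p ⊛ taylor q)
      ≈⟨ solve 4 (λ X Q L P → X :* Q :+ L :* (P :* Q) := (X :+ L :* P) :* Q) ≈-refl (const x) (taylor q) t₀+X (taylor p) ⟩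
    (const x ⊕ t₀+X ⊛ taylor p) ⊛ taylor q ∎
    where
    open ≈-Reasoning
    open ⊛-Solver

  taylor-pconst : ∀ c → taylor (pconst c) ≈ const c
  taylor-pconst c k = trans (cong (const c k +_) (⊛-𝟘 t₀+X k)) (+-identityʳ _)

  taylor-plin : ∀ c → taylor (plin c) ≈ const c ⊕ t₀+X
  taylor-plin c = ⊕-congˡ (const c) (≈-trans (⊛-congˡ t₀+X (taylor-pconst 1ℚ)) (≈-trans (⊛-comm t₀+X 𝟙) (𝟙-⊛ t₀+X)))

  taylor-ppow : ∀ p k → taylor (ppow p k) ≈ taylor p ^ₛ k
  taylor-ppow p zero    = taylor-pconst 1ℚ
  taylor-ppow p (suc k) = ≈-trans (taylor-pmul p (ppow p k)) (⊛-congˡ (taylor p) (taylor-ppow p k))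

  taylor-pprod : ∀ (F : ℕ → Poly) f m → taylor (pprod (map F (applyUpTo f m))) ≈ ∏[ l < m ] taylor (F (f l))
  taylor-pprod F f zero    = taylor-pconst 1ℚ
  taylor-pprod F f (suc m) = begin
    taylor (pmul (F (f 0)) (pprod (map F (applyUpTo (λ l → f (suc l)) m))))
      ≈⟨ taylor-pmul (F (f 0)) _ ⟩
    taylor (F (f 0)) ⊛ taylor (pprod (map F (applyUpTo (λ l → f (suc l)) m)))
      ≈⟨ ⊛-congˡ (taylor (F (f 0))) (taylor-pprod F (λ l → f (suc l)) m) ⟩
    taylor (F (f 0)) ⊛ ∏[ l < m ] taylor (F (f (suc l)))
      ≈⟨ ∏-suc (λ l → taylor (F (f l))) m ⟨
    ∏[ l < suc m ] taylor (F (f l)) ∎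
    where open ≈-Reasoning

  -- `pderiv` in Defs runs a local helper, which cannot be referred to by name; unification recovers it.
  private
    mutual
      pderiv-go : ℚ → Poly → ℕ → Poly → Poly
      pderiv-go = _

      pderiv-∷∷ : ∀ x y r → pderiv (x ∷ y ∷ r) ≡ (fromℕ 1 * y) ∷ pderiv-go x (y ∷ r) 2 r
      pderiv-∷∷ x y r with y ∷ r | 2
      ... | _ | _ = refl

    ∂-t₀+X : ∂ t₀+X ≈ 𝟙
    ∂-t₀+X zero    = *-identityˡ 1ℚ
    ∂-t₀+X (suc k) = *-zeroʳ (fromℕ (suc (suc k)))

    ∂-taylor-∷ : ∀ y r → ∂ (taylor (y ∷ r)) ≈ taylor r ⊕ t₀+X ⊛ ∂ (taylor r)
    ∂-taylor-∷ y r = begin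
      ∂ (const y ⊕ t₀+X ⊛ taylor r)                    ≈⟨ ∂-⊕ (const y) (t₀+X ⊛ taylor r) ⟩
      ∂ (const y) ⊕ ∂ (t₀+X ⊛ taylor r)                ≈⟨ ⊕-cong (∂-const y) (∂-⊛ t₀+X (taylor r)) ⟩
      𝟘 ⊕ (∂ t₀+X ⊛ taylor r ⊕ t₀+X ⊛ ∂ (taylor r))    ≈⟨ 𝟘-⊕ _ ⟩
      ∂ t₀+X ⊛ taylor r ⊕ t₀+X ⊛ ∂ (taylor r)          ≈⟨ ⊕-congʳ (t₀+X ⊛ ∂ (taylor r)) (⊛-congʳ (taylor r) ∂-t₀+X) ⟩
      𝟙 ⊛ taylor r ⊕ t₀+X ⊛ ∂ (taylor r)               ≈⟨ ⊕-congʳ (t₀+X ⊛ ∂ (taylor r)) (𝟙-⊛ (taylor r)) ⟩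
      taylor r ⊕ t₀+X ⊛ ∂ (taylor r)                   ∎
      where open ≈-Reasoning

    taylor-go : ∀ x P k r → taylor (pderiv-go x P k r) ≈ const (fromℕ k) ⊛ taylor r ⊕ t₀+X ⊛ ∂ (taylor r)
    taylor-go x P k [] = begin
      𝟘                                    ≈⟨ 𝟘-⊕ 𝟘 ⟨
      𝟘 ⊕ 𝟘                                ≈⟨ ⊕-cong (⊛-𝟘 (const (fromℕ k))) (≈-trans (⊛-congˡ t₀+X ∂-𝟘) (⊛-𝟘 t₀+X)) ⟨
      const (fromℕ k) ⊛ 𝟘 ⊕ t₀+X ⊛ ∂ 𝟘     ∎
      where open ≈-Reasoning
    taylor-go x P k (y ∷ r) = begin
      const (fromℕ k * y) ⊕ t₀+X ⊛ taylor (pderiv-go x P (suc k) r)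
        ≈⟨ ⊕-cong (const-* (fromℕ k) y) (⊛-congˡ t₀+X (taylor-go x P (suc k) r)) ⟩
      K ⊛ const y ⊕ t₀+X ⊛ (const (fromℕ (suc k)) ⊛ taylor r ⊕ t₀+X ⊛ ∂ (taylor r))
        ≈⟨ ⊕-congˡ (K ⊛ const y) (⊛-congˡ t₀+X (⊕-congʳ (t₀+X ⊛ ∂ (taylor r)) (⊛-congʳ (taylor r)
             (≈-trans (const-cong (fromℕ-suc k)) (const-+ 1ℚ (fromℕ k)))))) ⟩
      K ⊛ const y ⊕ t₀+X ⊛ ((𝟙 ⊕ K) ⊛ taylor r ⊕ t₀+X ⊛ ∂ (taylor r))
        ≈⟨ solve 6 (λ K Y L R D I → K :* Y :+ L :* ((I :+ K) :* R :+ L :* D) := K :* (Y :+ L :* R) :+ L :* (I :* R :+ L :* D))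
             ≈-refl K (const y) t₀+X (taylor r) (∂ (taylor r)) 𝟙 ⟩
      K ⊛ (const y ⊕ t₀+X ⊛ taylor r) ⊕ t₀+X ⊛ (𝟙 ⊛ taylor r ⊕ t₀+X ⊛ ∂ (taylor r))
        ≈⟨ ⊕-congˡ (K ⊛ taylor (y ∷ r)) (⊛-congˡ t₀+X
             (≈-trans (∂-taylor-∷ y r) (⊕-congʳ (t₀+X ⊛ ∂ (taylor r)) (≈-sym (𝟙-⊛ (taylor r)))))) ⟨
      K ⊛ taylor (y ∷ r) ⊕ t₀+X ⊛ ∂ (taylor (y ∷ r)) ∎
      where
      open ≈-Reasoning
      open ⊛-Solver
      K : Series
      K = const (fromℕ k)

  taylor-pderiv : ∀ p → taylor (pderiv p) ≈ ∂ (taylor p)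
  taylor-pderiv []      = ≈-sym ∂-𝟘
  taylor-pderiv (x ∷ q) = ≈-trans (taylor-go x q 1 q)
    (≈-trans (⊕-congʳ (t₀+X ⊛ ∂ (taylor q)) (𝟙-⊛ (taylor q))) (≈-sym (∂-taylor-∷ x q)))

  peval-padd : ∀ p q → peval (padd p q) t₀ ≡ peval p t₀ + peval q t₀
  peval-padd p q = trans (sym (taylor-0 (padd p q))) (trans (taylor-padd p q 0) (cong₂ _+_ (taylor-0 p) (taylor-0 q)))

  peval-pscale : ∀ c p → peval (pscale c p) t₀ ≡ c * peval p t₀
  peval-pscale c p = trans (sym (taylor-0 (pscale c p))) (trans (taylor-pscale c p 0) (cong (c *_) (taylor-0 p)))

  peval-pmul : ∀ p q → peval (pmul p q) t₀ ≡ peval p t₀ * peval q t₀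
  peval-pmul p q = trans (sym (taylor-0 (pmul p q))) (trans (taylor-pmul p q 0) (cong₂ _*_ (taylor-0 p) (taylor-0 q)))

  taylor-plin-X : ∀ c → taylor (plin c) ≈ const (c + t₀) ⊕ X
  taylor-plin-X c = begin
    taylor (plin c)            ≈⟨ taylor-plin c ⟩
    const c ⊕ t₀+X             ≈⟨ ⊕-congˡ (const c) t₀+X≈ ⟩
    const c ⊕ (const t₀ ⊕ X)   ≈⟨ solve 3 (λ a b x → a :+ (b :+ x) := a :+ b :+ x) ≈-refl (const c) (const t₀) X ⟩
    const c ⊕ const t₀ ⊕ X     ≈⟨ ⊕-congʳ X (const-+ c t₀) ⟨
    const (c + t₀) ⊕ X         ∎
    where
    open ≈-Reasoning
    open ⊛-Solver
    t₀+X≈ : t₀+X ≈ const t₀ ⊕ X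
    t₀+X≈ zero          = sym (+-identityʳ t₀)
    t₀+X≈ (suc zero)    = sym (+-identityˡ 1ℚ)
    t₀+X≈ (suc (suc k)) = sym (+-identityˡ 0ℚ)

module QuotientRule (t₀ : ℚ) where

  open import Data.Nat as ℕ using (ℕ; zero; suc; _!)
  import Data.Nat.Properties as ℕ
  open import Data.Rational using (0ℚ; 1ℚ; _*_; -_)
  open import Data.Rational.Properties
  open import Relation.Nullary using (¬_)
  open import Relation.Binary.PropositionalEquality
  open import Defs
  open Rationals
  open PowerSeries
  open SeriesDerivative
  open Taylor t₀

  rderiv-expansion : ∀ N D g → taylor D ⊛ g ≈ taylor N →
    taylor (RatFun.den (rderiv (N // D))) ⊛ ∂ g ≈ taylor (RatFun.num (rderiv (N // D)))
  rderiv-expansion N D g D⊛g≈N = begin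
    taylor (pmul D D) ⊛ ∂ g
      ≈⟨ ⊛-congʳ (∂ g) (taylor-pmul D D) ⟩
    TD ⊛ TD ⊛ ∂ g
      ≈⟨ ⊕-≈𝟘 (TD ⊛ TD ⊛ ∂ g) (≈𝟘-⊛ (∂ TD ⊛ g ⊛ TD) (const-inverseˡ 1ℚ)) ⟨
    TD ⊛ TD ⊛ ∂ g ⊕ (M ⊕ 𝟙) ⊛ (∂ TD ⊛ g ⊛ TD)
      ≈⟨ solve 5 (λ A B G DG M → A :* A :* DG :+ (M :+ con 1) :* (B :* G :* A) := (B :* G :+ A :* DG) :* A :+ M :* (A :* G :* B))
           ≈-refl TD (∂ TD) g (∂ g) M ⟩
    (∂ TD ⊛ g ⊕ TD ⊛ ∂ g) ⊛ TD ⊕ M ⊛ (TD ⊛ g ⊛ ∂ TD)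
      ≈⟨ ⊕-cong (⊛-congʳ TD (≈-trans (≈-sym (∂-⊛ TD g)) (∂-cong D⊛g≈N))) (⊛-congˡ M (⊛-congʳ (∂ TD) D⊛g≈N)) ⟩
    ∂ (taylor N) ⊛ TD ⊕ M ⊛ (taylor N ⊛ ∂ TD)
      ≈⟨ ⊕-cong (≈-trans (taylor-pmul (pderiv N) D) (⊛-congʳ TD (taylor-pderiv N)))
                (≈-trans (taylor-pscale (- 1ℚ) (pmul N (pderiv D)))
                         (⊛-congˡ M (≈-trans (taylor-pmul N (pderiv D)) (⊛-congˡ (taylor N) (taylor-pderiv D))))) ⟨
    taylor (pmul (pderiv N) D) ⊕ taylor (pscale (- 1ℚ) (pmul N (pderiv D)))
      ≈⟨ taylor-padd (pmul (pderiv N) D) (pscale (- 1ℚ) (pmul N (pderiv D))) ⟨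
    taylor (padd (pmul (pderiv N) D) (pscale (- 1ℚ) (pmul N (pderiv D)))) ∎
    where
    open ≈-Reasoning
    open ⊛-Solver
    TD : Series
    TD = taylor D
    M : Series
    M = const (- 1ℚ)

  reval-rderivN : ∀ l N D g → ¬ peval D t₀ ≡ 0ℚ → taylor D ⊛ g ≈ taylor N →
    reval (rderivN l (N // D)) t₀ ≡ fromℕ (l !) * g l
  reval-rderivN zero N D g D≢0 D⊛g≈N = begin
    peval N t₀ ÷' peval D t₀ ≡⟨ ÷'-unique D≢0 (trans (sym (taylor-0 N)) (trans (sym (D⊛g≈N 0)) (cong (_* g 0) (taylor-0 D)))) ⟩
    g 0                      ≡⟨ *-identityˡ (g 0) ⟨
    1ℚ * g 0                 ∎
    where open ≡-Reasoning
  reval-rderivN (suc l) N D g D≢0 D⊛g≈N = begin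
    reval (rderivN l (rderiv (N // D))) t₀       ≡⟨ reval-rderivN l _ _ (∂ g) D²≢0 (rderiv-expansion N D g D⊛g≈N) ⟩
    fromℕ (l !) * (fromℕ (suc l) * g (suc l))    ≡⟨ *-assoc (fromℕ (l !)) (fromℕ (suc l)) (g (suc l)) ⟨
    fromℕ (l !) * fromℕ (suc l) * g (suc l)      ≡⟨ cong (_* g (suc l)) (fromℕ-homo-* (l !) (suc l)) ⟨
    fromℕ (l ! ℕ.* suc l) * g (suc l)            ≡⟨ cong (λ m → fromℕ m * g (suc l)) (ℕ.*-comm (l !) (suc l)) ⟩
    fromℕ (suc l !) * g (suc l)                  ∎
    where
    open ≡-Reasoning
    D²≢0 : ¬ peval (pmul D D) t₀ ≡ 0ℚ
    D²≢0 rewrite peval-pmul D D = p*q≢0 D≢0 D≢0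

  Dλat-expansion : ∀ l N D g → ¬ peval D t₀ ≡ 0ℚ → taylor D ⊛ g ≈ taylor N → Dλat l (N // D) t₀ ≡ g l
  Dλat-expansion l N D g D≢0 D⊛g≈N = ÷'-unique (fromℕ-!≢0 l) (reval-rderivN l N D g D≢0 D⊛g≈N)

module Interpolation where

  open import Data.Nat as ℕ using (ℕ; zero; suc; _≤_; _<_; z≤n; s≤s; _∸_)
  import Data.Nat.Properties as ℕ
  open import Data.Rational using (ℚ; 0ℚ; 1ℚ; _+_; _*_; -_)
  open import Data.Rational.Properties
  open import Data.Rational.Solver using (module +-*-Solver)
  open import Data.List using (List; []; _∷_; length)
  import Data.List.Properties as List
  open import Relation.Nullary using (¬_; contradiction)
  open import Function using (_∘_)
  open import Relation.Binary.Definitions using (tri<; tri≈; tri>)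
  open import Relation.Binary.PropositionalEquality
  open import Defs hiding (c)
  open Rationals
  open PowerSeries

  length-padd : ∀ {m} p q → length p ≤ m → length q ≤ m → length (padd p q) ≤ m
  length-padd []      q       _         |q|≤m     = |q|≤m
  length-padd (x ∷ p) []      |p|≤m     _         = |p|≤m
  length-padd (x ∷ p) (y ∷ q) (s≤s |p|) (s≤s |q|) = s≤s (length-padd p q |p| |q|)

  length-pscale : ∀ c p → length (pscale c p) ≡ length p
  length-pscale c = List.length-map (c *_)

  length-pmul : ∀ d₁ d₂ p q → length p ≤ suc d₁ → length q ≤ suc d₂ → length (pmul p q) ≤ suc (d₁ ℕ.+ d₂)
  length-pmul d₁ d₂ []      q _ _ = z≤n
  length-pmul d₁ d₂ (x ∷ p) q |p| |q| = length-padd (pscale x q) (0ℚ ∷ pmul p q)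
    (subst (_≤ suc (d₁ ℕ.+ d₂)) (sym (length-pscale x q)) (ℕ.≤-trans |q| (s≤s (ℕ.m≤n+m d₂ d₁))))
    (shifted d₁ p |p|)
    where
    shifted : ∀ d₁ p → length (x ∷ p) ≤ suc d₁ → length (0ℚ ∷ pmul p q) ≤ suc (d₁ ℕ.+ d₂)
    shifted d₁        []      _         = s≤s z≤n
    shifted zero      (y ∷ p) (s≤s ())
    shifted (suc d₁) (y ∷ p) (s≤s |p|) = s≤s (length-pmul d₁ d₂ (y ∷ p) q |p| |q|)

  length-poch : ∀ c m → length (poch c m) ≤ suc m
  length-poch c zero    = ℕ.≤-refl
  length-poch c (suc m) = subst (λ u → length (poch c (suc m)) ≤ suc u) (ℕ.+-comm m 1)
    (length-pmul m 1 (poch c m) (plin (c + fromℕ m)) (length-poch c m) ℕ.≤-refl)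

  -- Synthetic division by t + c: E = E(-c) + (t + c) · quotient c E.
  quotient : ℚ → Poly → Poly
  quotient c []              = []
  quotient c (e ∷ [])        = []
  quotient c (e ∷ E@(_ ∷ _)) = peval E (- c) ∷ quotient c E

  length-quotient : ∀ c E → length (quotient c E) ≡ length E ∸ 1
  length-quotient c []              = refl
  length-quotient c (e ∷ [])        = refl
  length-quotient c (e ∷ E@(_ ∷ _)) = cong suc (length-quotient c E)

  module _ (t : ℚ) where
    open Taylor t

    taylor-quotient : ∀ c E → taylor E ≈ const (peval E (- c)) ⊕ taylor (plin c) ⊛ taylor (quotient c E)
    taylor-quotient c [] = begin
      𝟘                                       ≈⟨ ⊕-𝟘 𝟘 ⟨
      𝟘 ⊕ 𝟘                                   ≈⟨ ⊕-cong 𝟘≈const0 (≈-sym (⊛-𝟘 (taylor (plin c)))) ⟩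
      const 0ℚ ⊕ taylor (plin c) ⊛ 𝟘          ∎
      where open ≈-Reasoning
    taylor-quotient c (e ∷ []) = begin
      const e ⊕ t₀+X ⊛ 𝟘                      ≈⟨ ⊕-congˡ (const e) (⊛-𝟘 t₀+X) ⟩
      const e ⊕ 𝟘                             ≈⟨ ⊕-congˡ (const e) (⊛-𝟘 (taylor (plin c))) ⟨
      const e ⊕ taylor (plin c) ⊛ 𝟘           ≈⟨ ⊕-congʳ (taylor (plin c) ⊛ 𝟘) (const-cong e≡) ⟩
      const (e + - c * 0ℚ) ⊕ taylor (plin c) ⊛ 𝟘 ∎
      where
      open ≈-Reasoning
      e≡ : e ≡ e + - c * 0ℚ
      e≡ = sym (trans (cong (e +_) (*-zeroʳ (- c))) (+-identityʳ e))
    taylor-quotient c (e ∷ E@(_ ∷ _)) = begin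
      const e ⊕ t₀+X ⊛ taylor E
        ≈⟨ ⊕-congˡ (const e) (⊛-congˡ t₀+X (taylor-quotient c E)) ⟩
      const e ⊕ t₀+X ⊛ (const v ⊕ taylor (plin c) ⊛ Q)
        ≈⟨ ⊕-congˡ (const e) (⊛-congˡ t₀+X (⊕-congˡ (const v) (⊛-congʳ Q (taylor-plin c)))) ⟩
      const e ⊕ t₀+X ⊛ (const v ⊕ (const c ⊕ t₀+X) ⊛ Q)
        ≈⟨ ⊕-≈𝟘 _ (≈𝟘-⊛ (const v) (const-inverseˡ c)) ⟨
      const e ⊕ t₀+X ⊛ (const v ⊕ (const c ⊕ t₀+X) ⊛ Q) ⊕ (const (- c) ⊕ const c) ⊛ const v
        ≈⟨ solve 6 (λ E L V C M Q → E :+ L :* (V :+ (C :+ L) :* Q) :+ (M :+ C) :* V := E :+ M :* V :+ (C :+ L) :* (V :+ L :* Q))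
             ≈-refl (const e) t₀+X (const v) (const c) (const (- c)) Q ⟩
      const e ⊕ const (- c) ⊛ const v ⊕ (const c ⊕ t₀+X) ⊛ (const v ⊕ t₀+X ⊛ Q)
        ≈⟨ ⊕-cong (≈-trans (const-+ e (- c * v)) (⊕-congˡ (const e) (const-* (- c) v))) (⊛-congʳ (const v ⊕ t₀+X ⊛ Q) (taylor-plin c)) ⟨
      const (e + - c * v) ⊕ taylor (plin c) ⊛ taylor (v ∷ quotient c E) ∎
      where
      open ≈-Reasoning
      open ⊛-Solver
      v : ℚ
      v = peval E (- c)
      Q : Series
      Q = taylor (quotient c E)

    peval-quotient : ∀ c E → peval E t ≡ peval E (- c) + (c + t) * peval (quotient c E) t
    peval-quotient c E = trans (sym (taylor-0 E))
      (trans (taylor-quotient c E 0) (cong₂ (λ u w → peval E (- c) + u * w) (taylor-plin c 0) (taylor-0 (quotient c E))))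

  private
    quotient-vanishing : ∀ d E → (∀ i → i ≤ suc d → peval E (- fromℕ i) ≡ 0ℚ) →
                         ∀ i → i ≤ d → peval (quotient (fromℕ (suc d)) E) (- fromℕ i) ≡ 0ℚ
    quotient-vanishing d E E≡0 i i≤d = *-cancelˡ-≡0 (fromℕ-sub-≢0 (ℕ.<⇒≢ (s≤s i≤d) ∘ sym)) (begin
      (r + - fromℕ i) * peval Q (- fromℕ i)                 ≡⟨ +-identityˡ _ ⟨
      0ℚ + (r + - fromℕ i) * peval Q (- fromℕ i)            ≡⟨ cong (_+ ((r + - fromℕ i) * peval Q (- fromℕ i))) (E≡0 (suc d) ℕ.≤-refl) ⟨
      peval E (- r) + (r + - fromℕ i) * peval Q (- fromℕ i) ≡⟨ peval-quotient (- fromℕ i) r E ⟨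
      peval E (- fromℕ i)                                   ≡⟨ E≡0 i (ℕ.m≤n⇒m≤1+n i≤d) ⟩
      0ℚ                                                    ∎)
      where
      open ≡-Reasoning
      r : ℚ
      r = fromℕ (suc d)
      Q : Poly
      Q = quotient r E

  vanishing⇒taylor≈𝟘 : ∀ d E → length E ≤ suc d → (∀ i → i ≤ d → peval E (- fromℕ i) ≡ 0ℚ) →
                        ∀ t → Taylor.taylor t E ≈ 𝟘
  vanishing⇒taylor≈𝟘 zero []          _ _ t = ≈-refl
  vanishing⇒taylor≈𝟘 zero (e ∷ [])    _ E≡0 t k = begin
    (const e ⊕ t₀+X ⊛ 𝟘) k ≡⟨ ⊕-congˡ (const e) (⊛-𝟘 t₀+X) k ⟩
    const e k + 0ℚ         ≡⟨ cong (λ x → const x k + 0ℚ) e≡0 ⟩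
    const 0ℚ k + 0ℚ        ≡⟨ ⊕-𝟘 (const 0ℚ) k ⟩
    const 0ℚ k             ≡⟨ 𝟘≈const0 k ⟨
    0ℚ                     ∎
    where
    open Taylor t
    open ≡-Reasoning
    e≡0 : e ≡ 0ℚ
    e≡0 = trans (sym (trans (cong (e +_) (*-zeroʳ (- 0ℚ))) (+-identityʳ e))) (E≡0 0 z≤n)
  vanishing⇒taylor≈𝟘 zero    (e ∷ _ ∷ _) (s≤s ()) _ t
  vanishing⇒taylor≈𝟘 (suc d) E |E| E≡0 t = begin
    taylor E                                          ≈⟨ taylor-quotient t r E ⟩
    const (peval E (- r)) ⊕ taylor (plin r) ⊛ taylor Q ≈⟨ ⊕-cong (const-cong (E≡0 (suc d) ℕ.≤-refl)) (⊛-congˡ (taylor (plin r)) Q≈𝟘) ⟩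
    const 0ℚ ⊕ taylor (plin r) ⊛ 𝟘                    ≈⟨ ⊕-cong (≈-sym 𝟘≈const0) (⊛-𝟘 (taylor (plin r))) ⟩
    𝟘 ⊕ 𝟘                                             ≈⟨ ⊕-𝟘 𝟘 ⟩
    𝟘                                                 ∎
    where
    open Taylor t
    open ≈-Reasoning
    r : ℚ
    r = fromℕ (suc d)
    Q : Poly
    Q = quotient r E
    Q≈𝟘 : taylor Q ≈ 𝟘
    Q≈𝟘 = vanishing⇒taylor≈𝟘 d Q (subst (_≤ suc d) (sym (length-quotient r E)) (ℕ.∸-monoˡ-≤ 1 |E|))
            (quotient-vanishing d E E≡0) t

  prodExcept : ℕ → ℕ → Poly
  prodExcept n k = pmul (poch 0ℚ k) (poch (fromℕ (suc k)) (n ∸ k))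

  length-prodExcept : ∀ {n k} → k ≤ n → length (prodExcept n k) ≤ suc n
  length-prodExcept {n} {k} k≤n = subst (λ u → length (prodExcept n k) ≤ suc u) (ℕ.m+[n∸m]≡n k≤n)
    (length-pmul k (n ∸ k) (poch 0ℚ k) (poch (fromℕ (suc k)) (n ∸ k)) (length-poch 0ℚ k) (length-poch (fromℕ (suc k)) (n ∸ k)))

  module _ (t : ℚ) where
    open Taylor t

    taylor-poch : ∀ c m → taylor (poch c m) ≈ ∏[ l < m ] taylor (plin (c + fromℕ l))
    taylor-poch c zero    = taylor-pconst 1ℚ
    taylor-poch c (suc m) = ≈-trans (taylor-pmul (poch c m) (plin (c + fromℕ m))) (⊛-congʳ (taylor (plin (c + fromℕ m))) (taylor-poch c m))

    peval-poch : ∀ c m → peval (poch c m) t ≡ ∏ℚ[ l < m ] (c + fromℕ l + t)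
    peval-poch c m = begin
      peval (poch c m) t                          ≡⟨ taylor-0 (poch c m) ⟨
      taylor (poch c m) 0                         ≡⟨ taylor-poch c m 0 ⟩
      ∏< m (λ l → taylor (plin (c + fromℕ l))) 0  ≡⟨ ∏-0 _ m ⟩
      ∏ℚ[ l < m ] taylor (plin (c + fromℕ l)) 0   ≡⟨ ∏ℚ-cong m (λ l _ → taylor-plin (c + fromℕ l) 0) ⟩
      ∏ℚ[ l < m ] (c + fromℕ l + t)               ∎
      where open ≡-Reasoning

    taylor-prodExcept-* : ∀ {n k} → k ≤ n → taylor (prodExcept n k) ⊛ taylor (plin (fromℕ k)) ≈ taylor (poch 0ℚ (suc n))
    taylor-prodExcept-* {n} {k} k≤n = begin
      taylor (prodExcept n k) ⊛ L
        ≈⟨ ⊛-congʳ L (≈-trans (taylor-pmul (poch 0ℚ k) _) (⊛-cong (taylor-poch 0ℚ k) (taylor-poch (fromℕ (suc k)) (n ∸ k)))) ⟩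
      ∏< k F ⊛ ∏< (n ∸ k) G ⊛ L
        ≈⟨ solve 3 (λ a b c → a :* b :* c := a :* (c :* b)) ≈-refl (∏< k F) (∏< (n ∸ k) G) L ⟩
      ∏< k F ⊛ (L ⊛ ∏< (n ∸ k) G)
        ≈⟨ ⊛-congˡ (∏< k F) (⊛-cong (taylor-plin-cong (sym Fk≡)) (∏-cong (n ∸ k) (λ l _ → taylor-plin-cong (G≡F l)))) ⟩
      ∏< k F ⊛ (F (k ℕ.+ 0) ⊛ ∏[ l < n ∸ k ] F (k ℕ.+ suc l))
        ≈⟨ ⊛-congˡ (∏< k F) (∏-suc (λ l → F (k ℕ.+ l)) (n ∸ k)) ⟨
      ∏< k F ⊛ ∏[ l < suc (n ∸ k) ] F (k ℕ.+ l)
        ≈⟨ ∏-+ F k (suc (n ∸ k)) ⟨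
      ∏< (k ℕ.+ suc (n ∸ k)) F
        ≡⟨ cong (λ m → ∏< m F) (trans (ℕ.+-suc k (n ∸ k)) (cong suc (ℕ.m+[n∸m]≡n k≤n))) ⟩
      ∏< (suc n) F
        ≈⟨ taylor-poch 0ℚ (suc n) ⟨
      taylor (poch 0ℚ (suc n)) ∎
      where
      open ≈-Reasoning
      open ⊛-Solver
      L : Series
      L = taylor (plin (fromℕ k))
      F : ℕ → Series
      F = λ l → taylor (plin (0ℚ + fromℕ l))
      G : ℕ → Series
      G = λ l → taylor (plin (fromℕ (suc k) + fromℕ l))
      taylor-plin-cong : ∀ {x y} → x ≡ y → taylor (plin x) ≈ taylor (plin y)
      taylor-plin-cong refl = ≈-refl
      Fk≡ : 0ℚ + fromℕ (k ℕ.+ 0) ≡ fromℕ k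
      Fk≡ = trans (+-identityˡ _) (cong fromℕ (ℕ.+-identityʳ k))
      G≡F : ∀ l → fromℕ (suc k) + fromℕ l ≡ 0ℚ + fromℕ (k ℕ.+ suc l)
      G≡F l = trans (sym (fromℕ-homo-+ (suc k) l)) (trans (cong fromℕ (sym (ℕ.+-suc k l))) (sym (+-identityˡ _)))

  peval-prodExcept : ∀ n k t → peval (prodExcept n k) t ≡ ∏ℚ[ l < k ] (0ℚ + fromℕ l + t) * ∏ℚ[ l < n ∸ k ] (fromℕ (suc k) + fromℕ l + t)
  peval-prodExcept n k t = trans (peval-pmul (poch 0ℚ k) _) (cong₂ _*_ (peval-poch t 0ℚ k) (peval-poch t (fromℕ (suc k)) (n ∸ k)))
    where open Taylor t

  peval-prodExcept-≡0 : ∀ {n k i} → i ≤ n → ¬ i ≡ k → peval (prodExcept n k) (- fromℕ i) ≡ 0ℚ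
  peval-prodExcept-≡0 {n} {k} {i} i≤n i≢k with ℕ.<-cmp i k
  ... | tri≈ _ i≡k _ = contradiction i≡k i≢k
  ... | tri< i<k _ _ = trans (peval-prodExcept n k t) (trans (cong (_* P₂) P₁≡0) (*-zeroˡ P₂))
    where
    t : ℚ
    t = - fromℕ i
    P₂ : ℚ
    P₂ = ∏ℚ[ l < n ∸ k ] (fromℕ (suc k) + fromℕ l + t)
    P₁≡0 : ∏ℚ[ l < k ] (0ℚ + fromℕ l + t) ≡ 0ℚ
    P₁≡0 = ∏ℚ-≡0 (λ l → 0ℚ + fromℕ l + t) i i<k (trans (cong (_+ t) (+-identityˡ (fromℕ i))) (+-inverseʳ (fromℕ i)))
  ... | tri> _ _ k<i = trans (peval-prodExcept n k t) (trans (cong (P₁ *_) P₂≡0) (*-zeroʳ P₁))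
    where
    t : ℚ
    t = - fromℕ i
    P₁ : ℚ
    P₁ = ∏ℚ[ l < k ] (0ℚ + fromℕ l + t)
    factor≡0 : fromℕ (suc k) + fromℕ (i ∸ suc k) + t ≡ 0ℚ
    factor≡0 = trans (cong (_+ t) (trans (sym (fromℕ-homo-+ (suc k) (i ∸ suc k))) (cong fromℕ (ℕ.m+[n∸m]≡n k<i))))
                     (+-inverseʳ (fromℕ i))
    P₂≡0 : ∏ℚ[ l < n ∸ k ] (fromℕ (suc k) + fromℕ l + t) ≡ 0ℚ
    P₂≡0 = ∏ℚ-≡0 (λ l → fromℕ (suc k) + fromℕ l + t) (i ∸ suc k) (ℕ.∸-monoˡ-< (s≤s i≤n) k<i) factor≡0

  peval-prodExcept-≢0 : ∀ n k → ¬ peval (prodExcept n k) (- fromℕ k) ≡ 0ℚ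
  peval-prodExcept-≢0 n k rewrite peval-prodExcept n k (- fromℕ k) = p*q≢0
    (∏ℚ-≢0 _ k (λ l l<k → fromℕ-sub-≢0 (ℕ.<⇒≢ l<k) ∘ trans (cong (_+ - fromℕ k) (sym (+-identityˡ (fromℕ l))))))
    (∏ℚ-≢0 _ (n ∸ k) (λ l _ → fromℕ-sub-≢0 (ℕ.m+1+n≢m k ∘ k+1+l≡k l) ∘ trans (cong (_+ - fromℕ k) (fromℕ-homo-+ (suc k) l))))
    where
    k+1+l≡k : ∀ l → suc k ℕ.+ l ≡ k → k ℕ.+ suc l ≡ k
    k+1+l≡k l eq = trans (ℕ.+-suc k l) (trans (cong suc (ℕ.+-comm k l)) (trans (sym (ℕ.+-suc l k)) (trans (ℕ.+-comm l (suc k)) eq)))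

  lagrangeWeight : ℕ → Poly → ℕ → ℚ
  lagrangeWeight n P k = peval P (- fromℕ k) ÷' peval (prodExcept n k) (- fromℕ k)

  private
    interpolant : ℕ → Poly → ℕ → Poly
    interpolant n P zero    = []
    interpolant n P (suc m) = padd (interpolant n P m) (pscale (lagrangeWeight n P m) (prodExcept n m))

    length-interpolant : ∀ n P m → m ≤ suc n → length (interpolant n P m) ≤ suc n
    length-interpolant n P zero    _         = z≤n
    length-interpolant n P (suc m) (s≤s m≤n) = length-padd (interpolant n P m) (pscale (lagrangeWeight n P m) (prodExcept n m))
      (length-interpolant n P m (ℕ.m≤n⇒m≤1+n m≤n))
      (subst (_≤ suc n) (sym (length-pscale (lagrangeWeight n P m) (prodExcept n m))) (length-prodExcept m≤n))

    peval-interpolant : ∀ n P m t → peval (interpolant n P m) t ≡ ∑ℚ[ k < m ] (lagrangeWeight n P k * peval (prodExcept n k) t)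
    peval-interpolant n P zero    t = refl
    peval-interpolant n P (suc m) t = trans (peval-padd (interpolant n P m) _)
      (cong₂ _+_ (peval-interpolant n P m t) (peval-pscale (lagrangeWeight n P m) (prodExcept n m)))
      where open Taylor t

    peval-interpolant-node : ∀ n P {i} → i ≤ n → peval (interpolant n P (suc n)) (- fromℕ i) ≡ peval P (- fromℕ i)
    peval-interpolant-node n P {i} i≤n = begin
      peval (interpolant n P (suc n)) (- fromℕ i)
        ≡⟨ peval-interpolant n P (suc n) (- fromℕ i) ⟩
      ∑ℚ[ k < suc n ] (lagrangeWeight n P k * peval (prodExcept n k) (- fromℕ i))
        ≡⟨ ∑ℚ-single _ i (s≤s i≤n) (λ k _ k≢i →
             trans (cong (lagrangeWeight n P k *_) (peval-prodExcept-≡0 i≤n (k≢i ∘ sym))) (*-zeroʳ (lagrangeWeight n P k))) ⟩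
      lagrangeWeight n P i * peval (prodExcept n i) (- fromℕ i)
        ≡⟨ *-comm (lagrangeWeight n P i) _ ⟩
      peval (prodExcept n i) (- fromℕ i) * lagrangeWeight n P i
        ≡⟨ ÷'-*-cancel (peval P (- fromℕ i)) (peval-prodExcept-≢0 n i) ⟩
      peval P (- fromℕ i) ∎
      where open ≡-Reasoning

    taylor-interpolant : ∀ n P m t → Taylor.taylor t (interpolant n P m)
                                     ≈ ∑[ k < m ] (const (lagrangeWeight n P k) ⊛ Taylor.taylor t (prodExcept n k))
    taylor-interpolant n P zero    t = ≈-refl
    taylor-interpolant n P (suc m) t = ≈-trans (taylor-padd (interpolant n P m) _)
      (⊕-cong (taylor-interpolant n P m t) (taylor-pscale (lagrangeWeight n P m) (prodExcept n m)))
      where open Taylor t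

  -- P minus its interpolant has degree ≤ n and vanishes at the n + 1 nodes 0, -1, …, -n.
  lagrange : ∀ n P → length P ≤ suc n → ∀ t →
             Taylor.taylor t P ≈ ∑[ k < suc n ] (const (lagrangeWeight n P k) ⊛ Taylor.taylor t (prodExcept n k))
  lagrange n P |P| t = ≈-trans P≈L (taylor-interpolant n P (suc n) t)
    where
    open Taylor t
    L : Poly
    L = interpolant n P (suc n)
    E : Poly
    E = padd P (pscale (- 1ℚ) L)
    |E| : length E ≤ suc n
    |E| = length-padd P (pscale (- 1ℚ) L) |P|
            (subst (_≤ suc n) (sym (length-pscale (- 1ℚ) L)) (length-interpolant n P (suc n) ℕ.≤-refl))
    E≡0 : ∀ i → i ≤ n → peval E (- fromℕ i) ≡ 0ℚ
    E≡0 i i≤n = begin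
      peval E x                                ≡⟨ Taylor.peval-padd x P (pscale (- 1ℚ) L) ⟩
      peval P x + peval (pscale (- 1ℚ) L) x    ≡⟨ cong (peval P x +_) (Taylor.peval-pscale x (- 1ℚ) L) ⟩
      peval P x + - 1ℚ * peval L x             ≡⟨ cong (λ u → peval P x + - 1ℚ * u) (peval-interpolant-node n P i≤n) ⟩
      peval P x + - 1ℚ * peval P x             ≡⟨ solve 1 (λ a → a :+ :- con 1ℚ :* a := con 0ℚ) refl (peval P x) ⟩
      0ℚ                                       ∎
      where
      open ≡-Reasoning
      open +-*-Solver
      x : ℚ
      x = - fromℕ i
    P≈L : taylor P ≈ taylor L
    P≈L = begin
      taylor P
        ≈⟨ ⊕-≈𝟘 (taylor P) (≈𝟘-⊛ (taylor L) (const-inverseˡ 1ℚ)) ⟨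
      taylor P ⊕ (const (- 1ℚ) ⊕ 𝟙) ⊛ taylor L
        ≈⟨ solve 3 (λ p m l → p :+ (m :+ con 1) :* l := p :+ m :* l :+ l) ≈-refl (taylor P) (const (- 1ℚ)) (taylor L) ⟩
      taylor P ⊕ const (- 1ℚ) ⊛ taylor L ⊕ taylor L
        ≈⟨ ⊕-congʳ (taylor L) (⊕-congˡ (taylor P) (taylor-pscale (- 1ℚ) L)) ⟨
      taylor P ⊕ taylor (pscale (- 1ℚ) L) ⊕ taylor L
        ≈⟨ ⊕-congʳ (taylor L) (≈-trans (≈-sym (taylor-padd P (pscale (- 1ℚ) L))) (vanishing⇒taylor≈𝟘 n E |E| E≡0 t)) ⟩
      𝟘 ⊕ taylor L
        ≈⟨ 𝟘-⊕ (taylor L) ⟩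
      taylor L ∎
      where
      open ≈-Reasoning
      open ⊛-Solver

module LagrangeWeights where

  open import Data.Nat as ℕ using (ℕ; zero; suc; _≤_; _∸_; _!)
  import Data.Nat.Properties as ℕ
  open import Data.Nat.Divisibility using (_∣_; divides; ∣-trans; *-cancelʳ-∣)
  open import Data.Nat.Combinatorics using (k![n∸k]!∣n!)
  open import Data.Rational using (ℚ; 0ℚ; 1ℚ; _+_; _*_; -_)
  open import Data.Rational.Properties
  open import Data.Rational.Solver using (module +-*-Solver)
  open import Relation.Nullary using (¬_)
  open import Relation.Binary.PropositionalEquality
  open import Defs hiding (c)
  open Rationals
  open Interpolation
  open +-*-Solver

  infixl 8 _↑_

  _↑_ : ℕ → ℕ → ℕ
  a ↑ zero  = 1
  a ↑ suc m = a ↑ m ℕ.* (a ℕ.+ m)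

  rising : ℚ → ℕ → ℚ
  rising x m = ∏ℚ[ l < m ] (x + fromℕ l)

  sign : ℕ → ℚ
  sign m = (- 1ℚ) ^ℚ m

  sign²≡1 : ∀ m → sign m * sign m ≡ 1ℚ
  sign²≡1 zero    = refl
  sign²≡1 (suc m) = begin
    (- 1ℚ * sign m) * (- 1ℚ * sign m) ≡⟨ solve 2 (λ a b → (a :* b) :* (a :* b) := (a :* a) :* (b :* b)) refl (- 1ℚ) (sign m) ⟩
    (- 1ℚ * - 1ℚ) * (sign m * sign m) ≡⟨ cong ((- 1ℚ * - 1ℚ) *_) (sign²≡1 m) ⟩
    1ℚ                                ∎
    where open ≡-Reasoning

  IsInt-sign : ∀ m → IsInt (sign m)
  IsInt-sign zero    = IsInt-fromℕ 1
  IsInt-sign (suc m) = IsInt-* (IsInt-neg (IsInt-fromℕ 1)) (IsInt-sign m)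

  rising-fromℕ : ∀ a m → rising (fromℕ a) m ≡ fromℕ (a ↑ m)
  rising-fromℕ a zero    = refl
  rising-fromℕ a (suc m) = trans (cong₂ _*_ (rising-fromℕ a m) (sym (fromℕ-homo-+ a m))) (sym (fromℕ-homo-* (a ↑ m) (a ℕ.+ m)))

  1↑m≡m! : ∀ m → 1 ↑ m ≡ m !
  1↑m≡m! zero    = refl
  1↑m≡m! (suc m) = trans (cong (ℕ._* suc m) (1↑m≡m! m)) (ℕ.*-comm (m !) (suc m))

  [1+y]↑m*y!≡[y+m]! : ∀ y m → suc y ↑ m ℕ.* y ! ≡ (y ℕ.+ m) !
  [1+y]↑m*y!≡[y+m]! y zero    = trans (ℕ.*-identityˡ (y !)) (cong _! (sym (ℕ.+-identityʳ y)))
  [1+y]↑m*y!≡[y+m]! y (suc m) = begin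
    suc y ↑ m ℕ.* (suc y ℕ.+ m) ℕ.* y ! ≡⟨ ℕ.*-assoc (suc y ↑ m) (suc y ℕ.+ m) (y !) ⟩
    suc y ↑ m ℕ.* ((suc y ℕ.+ m) ℕ.* y !) ≡⟨ cong (suc y ↑ m ℕ.*_) (ℕ.*-comm (suc y ℕ.+ m) (y !)) ⟩
    suc y ↑ m ℕ.* (y ! ℕ.* (suc y ℕ.+ m)) ≡⟨ ℕ.*-assoc (suc y ↑ m) (y !) (suc y ℕ.+ m) ⟨
    suc y ↑ m ℕ.* y ! ℕ.* (suc y ℕ.+ m) ≡⟨ cong (ℕ._* (suc y ℕ.+ m)) ([1+y]↑m*y!≡[y+m]! y m) ⟩
    (y ℕ.+ m) ! ℕ.* suc (y ℕ.+ m)       ≡⟨ ℕ.*-comm ((y ℕ.+ m) !) (suc (y ℕ.+ m)) ⟩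
    suc (y ℕ.+ m) !                     ≡⟨ cong _! (ℕ.+-suc y m) ⟨
    (y ℕ.+ suc m) !                     ∎
    where open ≡-Reasoning

  -- m consecutive positive integers have a product divisible by m!, as (y+m)!/y! = m! · C(y+m, m).
  m!∣[1+y]↑m : ∀ y m → m ! ∣ suc y ↑ m
  m!∣[1+y]↑m y m = *-cancelʳ-∣ (y !) {{y ℕ.!≢0}}
    (subst (m ! ℕ.* y ! ∣_) (sym ([1+y]↑m*y!≡[y+m]! y m))
      (subst (λ u → m ! ℕ.* y ! ∣ u !) (ℕ.+-comm m y)
        (subst (λ u → m ! ℕ.* u ! ∣ (m ℕ.+ y) !) (ℕ.m+n∸m≡n m y) (k![n∸k]!∣n! (ℕ.m≤m+n m y)))))

  rising-suc : ∀ x m → rising x (suc m) ≡ x * rising (x + 1ℚ) m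
  rising-suc x zero    = solve 1 (λ a → con 1ℚ :* (a :+ con 0ℚ) := a :* con 1ℚ) refl x
  rising-suc x (suc m) = begin
    rising x (suc m) * (x + fromℕ (suc m))        ≡⟨ cong₂ _*_ (rising-suc x m) (cong (x +_) (fromℕ-suc m)) ⟩
    x * rising (x + 1ℚ) m * (x + (1ℚ + fromℕ m))  ≡⟨ solve 3 (λ a b d → a :* b :* (a :+ (con 1ℚ :+ d)) := a :* (b :* (a :+ con 1ℚ :+ d)))
                                                        refl x (rising (x + 1ℚ) m) (fromℕ m) ⟩
    x * (rising (x + 1ℚ) m * (x + 1ℚ + fromℕ m))  ∎
    where open ≡-Reasoning

  rising-reflect : ∀ x m → rising x m ≡ sign m * rising (1ℚ + - x + - fromℕ m) m
  rising-reflect x zero    = refl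
  rising-reflect x (suc m) = begin
    rising x (suc m)                                        ≡⟨ rising-suc x m ⟩
    x * rising (x + 1ℚ) m                                   ≡⟨ cong (x *_) (rising-reflect (x + 1ℚ) m) ⟩
    x * (sign m * rising (1ℚ + - (x + 1ℚ) + - fromℕ m) m)   ≡⟨ cong (λ u → x * (sign m * rising u m)) y≡ ⟩
    x * (sign m * rising y m)                               ≡⟨ solve 3 (λ a s r → a :* (s :* r) := (:- con 1ℚ :* s) :* (r :* (:- a)))
                                                                 refl x (sign m) (rising y m) ⟩
    (- 1ℚ * sign m) * (rising y m * - x)                    ≡⟨ cong (λ u → (- 1ℚ * sign m) * (rising y m * u)) -x≡ ⟩
    (- 1ℚ * sign m) * (rising y m * (y + fromℕ m))          ≡⟨ cong (λ u → (- 1ℚ * sign m) * rising u (suc m)) y≡′ ⟩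
    sign (suc m) * rising (1ℚ + - x + - fromℕ (suc m)) (suc m) ∎
    where
    open ≡-Reasoning
    y : ℚ
    y = - x + - fromℕ m
    y≡ : 1ℚ + - (x + 1ℚ) + - fromℕ m ≡ y
    y≡ = solve 2 (λ a b → con 1ℚ :+ :- (a :+ con 1ℚ) :+ :- b := :- a :+ :- b) refl x (fromℕ m)
    -x≡ : - x ≡ y + fromℕ m
    -x≡ = solve 2 (λ a b → :- a := :- a :+ :- b :+ b) refl x (fromℕ m)
    y≡′ : y ≡ 1ℚ + - x + - fromℕ (suc m)
    y≡′ = trans (solve 2 (λ a b → :- a :+ :- b := con 1ℚ :+ :- a :+ :- (con 1ℚ :+ b)) refl x (fromℕ m))
                (cong (λ u → 1ℚ + - x + - u) (sym (fromℕ-suc m)))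

  peval-poch-rising : ∀ c m t → peval (poch c m) t ≡ rising (c + t) m
  peval-poch-rising c m t = trans (peval-poch t c m)
    (∏ℚ-cong m (λ l _ → solve 3 (λ a b e → a :+ b :+ e := a :+ e :+ b) refl c (fromℕ l) t))

  peval-prodExcept-node : ∀ {n k} → k ≤ n → peval (prodExcept n k) (- fromℕ k) ≡ sign k * fromℕ (k ! ℕ.* (n ∸ k) !)
  peval-prodExcept-node {n} {k} k≤n = begin
    peval (prodExcept n k) (- fromℕ k)
      ≡⟨ Taylor.peval-pmul (- fromℕ k) (poch 0ℚ k) (poch (fromℕ (suc k)) (n ∸ k)) ⟩
    peval (poch 0ℚ k) (- fromℕ k) * peval (poch (fromℕ (suc k)) (n ∸ k)) (- fromℕ k)
      ≡⟨ cong₂ _*_ (peval-poch-rising 0ℚ k (- fromℕ k)) (peval-poch-rising (fromℕ (suc k)) (n ∸ k) (- fromℕ k)) ⟩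
    rising (0ℚ + - fromℕ k) k * rising (fromℕ (suc k) + - fromℕ k) (n ∸ k)
      ≡⟨ cong₂ _*_ (rising-reflect (0ℚ + - fromℕ k) k) (cong (λ x → rising x (n ∸ k)) [1+k]-k≡1) ⟩
    sign k * rising (1ℚ + - (0ℚ + - fromℕ k) + - fromℕ k) k * rising 1ℚ (n ∸ k)
      ≡⟨ cong (λ x → sign k * rising x k * rising 1ℚ (n ∸ k)) reflected≡1 ⟩
    sign k * rising 1ℚ k * rising 1ℚ (n ∸ k)
      ≡⟨ cong₂ (λ u v → sign k * u * v) (rising-factorial k) (rising-factorial (n ∸ k)) ⟩
    sign k * fromℕ (k !) * fromℕ ((n ∸ k) !)
      ≡⟨ trans (*-assoc (sign k) _ _) (cong (sign k *_) (sym (fromℕ-homo-* (k !) ((n ∸ k) !)))) ⟩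
    sign k * fromℕ (k ! ℕ.* (n ∸ k) !) ∎
    where
    open ≡-Reasoning
    rising-factorial : ∀ m → rising 1ℚ m ≡ fromℕ (m !)
    rising-factorial m = trans (rising-fromℕ 1 m) (cong fromℕ (1↑m≡m! m))
    reflected≡1 : 1ℚ + - (0ℚ + - fromℕ k) + - fromℕ k ≡ 1ℚ
    reflected≡1 = trans (cong (λ u → 1ℚ + - u + - fromℕ k) (+-identityˡ (- fromℕ k)))
                        (solve 1 (λ a → con 1ℚ :+ :- (:- a) :+ :- a := con 1ℚ) refl (fromℕ k))
    [1+k]-k≡1 : fromℕ (suc k) + - fromℕ k ≡ 1ℚ
    [1+k]-k≡1 = trans (fromℕ-∸ (ℕ.n≤1+n k)) (cong fromℕ (ℕ.m+n∸n≡m 1 k))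

  IsInt-lagrangeWeight : ∀ {n k s X} P → k ≤ n → IsInt s → peval P (- fromℕ k) ≡ s * fromℕ X →
                         k ! ℕ.* (n ∸ k) ! ∣ X → IsInt (lagrangeWeight n P k)
  IsInt-lagrangeWeight {n} {k} {s} P k≤n s-int P[-k]≡ (divides Y refl) =
    subst IsInt (sym (begin
      lagrangeWeight n P k
        ≡⟨ cong₂ _÷'_ P[-k]≡ (peval-prodExcept-node k≤n) ⟩
      (s * fromℕ (Y ℕ.* D)) ÷' (sign k * fromℕ D)
        ≡⟨ ÷'-unique (p*q≢0 sign≢0 (fromℕ-≢0 D≢0)) quotient≡ ⟩
      s * sign k * fromℕ Y ∎))
      (IsInt-* (IsInt-* s-int (IsInt-sign k)) (IsInt-fromℕ Y))
    where
    open ≡-Reasoning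
    D : ℕ
    D = k ! ℕ.* (n ∸ k) !
    D≢0 : ¬ D ≡ 0
    D≢0 = ℕ.≢-nonZero⁻¹ D {{k ℕ.!* (n ∸ k) !≢0}}
    sign≢0 : ¬ sign k ≡ 0ℚ
    sign≢0 sign≡0 = 1≢0 (trans (sym (sign²≡1 k)) (trans (cong (sign k *_) sign≡0) (*-zeroʳ (sign k))))
    quotient≡ : s * fromℕ (Y ℕ.* D) ≡ sign k * fromℕ D * (s * sign k * fromℕ Y)
    quotient≡ = begin
      s * fromℕ (Y ℕ.* D)                         ≡⟨ cong (s *_) (fromℕ-homo-* Y D) ⟩
      s * (fromℕ Y * fromℕ D)                     ≡⟨ solve 3 (λ a c e → a :* (c :* e) := con 1ℚ :* (a :* c :* e)) refl s (fromℕ Y) (fromℕ D) ⟩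
      1ℚ * (s * fromℕ Y * fromℕ D)                ≡⟨ cong (_* (s * fromℕ Y * fromℕ D)) (sign²≡1 k) ⟨
      sign k * sign k * (s * fromℕ Y * fromℕ D)   ≡⟨ solve 4 (λ a b c e → (b :* b) :* (a :* c :* e) := b :* e :* (a :* b :* c))
                                                       refl s (sign k) (fromℕ Y) (fromℕ D) ⟩
      sign k * fromℕ D * (s * sign k * fromℕ Y)   ∎

  IsInt-lagrangeWeight-poch-n : ∀ {n k} → k ≤ n → IsInt (lagrangeWeight n (poch (- fromℕ n) n) k)
  IsInt-lagrangeWeight-poch-n {n} {k} k≤n =
    IsInt-lagrangeWeight (poch (- fromℕ n) n) k≤n (IsInt-sign n) value (∣-trans (k![n∸k]!∣n! k≤n) (m!∣[1+y]↑m k n))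
    where
    open ≡-Reasoning
    value : peval (poch (- fromℕ n) n) (- fromℕ k) ≡ sign n * fromℕ (suc k ↑ n)
    value = begin
      peval (poch (- fromℕ n) n) (- fromℕ k)                   ≡⟨ peval-poch-rising (- fromℕ n) n (- fromℕ k) ⟩
      rising (- fromℕ n + - fromℕ k) n                         ≡⟨ rising-reflect (- fromℕ n + - fromℕ k) n ⟩
      sign n * rising (1ℚ + - (- fromℕ n + - fromℕ k) + - fromℕ n) n
        ≡⟨ cong (λ x → sign n * rising x n) (trans (solve 2 (λ a b → con 1ℚ :+ :- (:- a :+ :- b) :+ :- a := con 1ℚ :+ b) refl (fromℕ n) (fromℕ k))
                                                   (sym (fromℕ-suc k))) ⟩
      sign n * rising (fromℕ (suc k)) n                        ≡⟨ cong (sign n *_) (rising-fromℕ (suc k) n) ⟩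
      sign n * fromℕ (suc k ↑ n)                               ∎

  IsInt-lagrangeWeight-poch-n+1 : ∀ {n k} → k ≤ n → IsInt (lagrangeWeight n (poch (fromℕ (suc n)) n) k)
  IsInt-lagrangeWeight-poch-n+1 {n} {k} k≤n =
    IsInt-lagrangeWeight (poch (fromℕ (suc n)) n) k≤n (IsInt-fromℕ 1) value (∣-trans (k![n∸k]!∣n! k≤n) (m!∣[1+y]↑m (n ∸ k) n))
    where
    open ≡-Reasoning
    [1+n]-k≡ : fromℕ (suc n) + - fromℕ k ≡ fromℕ (suc (n ∸ k))
    [1+n]-k≡ = trans (fromℕ-∸ (ℕ.m≤n⇒m≤1+n k≤n)) (cong fromℕ (ℕ.+-∸-assoc 1 k≤n))
    value : peval (poch (fromℕ (suc n)) n) (- fromℕ k) ≡ 1ℚ * fromℕ (suc (n ∸ k) ↑ n)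
    value = begin
      peval (poch (fromℕ (suc n)) n) (- fromℕ k) ≡⟨ peval-poch-rising (fromℕ (suc n)) n (- fromℕ k) ⟩
      rising (fromℕ (suc n) + - fromℕ k) n       ≡⟨ cong (λ x → rising x n) [1+n]-k≡ ⟩
      rising (fromℕ (suc (n ∸ k))) n             ≡⟨ rising-fromℕ (suc (n ∸ k)) n ⟩
      fromℕ (suc (n ∸ k) ↑ n)                    ≡⟨ *-identityˡ _ ⟨
      1ℚ * fromℕ (suc (n ∸ k) ↑ n)               ∎

  IsInt-lagrangeWeight-n! : ∀ {n k} → k ≤ n → IsInt (lagrangeWeight n (pconst (fromℕ (n !))) k)
  IsInt-lagrangeWeight-n! {n} {k} k≤n = IsInt-lagrangeWeight (pconst (fromℕ (n !))) k≤n (IsInt-fromℕ 1) value (k![n∸k]!∣n! k≤n)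
    where
    value : peval (pconst (fromℕ (n !))) (- fromℕ k) ≡ 1ℚ * fromℕ (n !)
    value = trans (trans (cong (fromℕ (n !) +_) (*-zeroʳ (- fromℕ k))) (+-identityʳ (fromℕ (n !)))) (sym (*-identityˡ (fromℕ (n !))))

module LeastCommonMultiple where

  open import Data.Nat using (suc; _≤_)
  open import Data.Nat.Divisibility using (_∣_; ∣-trans)
  open import Data.Nat.LCM using (lcm; m∣lcm[m,n]; n∣lcm[m,n])
  open import Data.List using ([]; _∷_; foldr; map; upTo)
  open import Data.List.Relation.Unary.All as All using (All; []; _∷_)
  import Data.List.Relation.Unary.All.Properties as All
  open import Defs using (dlcm)

  private
    ∣foldr-lcm : ∀ xs → All (_∣ foldr lcm 1 xs) xs
    ∣foldr-lcm []       = []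
    ∣foldr-lcm (x ∷ xs) = m∣lcm[m,n] x (foldr lcm 1 xs) ∷ All.map (λ p → ∣-trans p (n∣lcm[m,n] x (foldr lcm 1 xs))) (∣foldr-lcm xs)

  ∣dlcm : ∀ {m n} → 1 ≤ m → m ≤ n → m ∣ dlcm n
  ∣dlcm {suc i} {n} _ i<n = All.applyUpTo⁻ (λ x → x) n (All.map⁻ (∣foldr-lcm (map suc (upTo n)))) i<n

module ExpansionAtNode (n j : ℕ) (j≤n : j ≤ n) where

  open import Data.Nat as ℕ using (suc; _<_; _∸_)
  import Data.Nat.Properties as ℕ
  open import Data.Nat.Divisibility using (divides)
  open import Data.Rational using (ℚ; _+_; _*_; -_)
  open import Data.Rational.Properties
  open import Data.Rational.Solver using (module +-*-Solver)
  open import Data.List using (length)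
  open import Data.Product using (Σ; _×_; _,_)
  open import Relation.Nullary using (¬_; yes; no; contradiction)
  open import Relation.Binary.Definitions using (tri<; tri≈; tri>)
  open import Relation.Binary.PropositionalEquality
  open import Defs hiding (c)
  open Rationals
  open PowerSeries
  open IntegralSeries
  open Interpolation
  open LeastCommonMultiple

  t₀ : ℚ
  t₀ = - fromℕ j

  open Taylor t₀ public

  d : ℕ
  d = dlcm n

  Q : Series
  Q = taylor (prodExcept n j)

  -- The expansion of (t + j)/(t + k) at t₀ = -j.
  H : ℕ → Series
  H k with k ℕ.≟ j
  ... | yes _ = 𝟙
  ... | no  _ = X· invLinear (fromℕ k + t₀)

  Q⊛H≈prodExcept : ∀ {k} → k ≤ n → Q ⊛ H k ≈ taylor (prodExcept n k)
  Q⊛H≈prodExcept {k} k≤n with k ℕ.≟ j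
  ... | yes refl = ≈-trans (⊛-comm Q 𝟙) (𝟙-⊛ Q)
  ... | no  k≢j  = begin
    Q ⊛ X· G                                              ≈⟨ ⊛-congˡ Q (X-⊛ G) ⟨
    Q ⊛ (X ⊛ G)                                           ≈⟨ ⊛-congˡ Q (⊛-congʳ G X≈) ⟩
    Q ⊛ (taylor (plin (fromℕ j)) ⊛ G)                     ≈⟨ ⊛-assoc Q _ G ⟨
    Q ⊛ taylor (plin (fromℕ j)) ⊛ G                       ≈⟨ ⊛-congʳ G (≈-trans (taylor-prodExcept-* t₀ j≤n) (≈-sym (taylor-prodExcept-* t₀ k≤n))) ⟩
    taylor (prodExcept n k) ⊛ taylor (plin (fromℕ k)) ⊛ G ≈⟨ ⊛-assoc (taylor (prodExcept n k)) _ G ⟩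
    taylor (prodExcept n k) ⊛ (taylor (plin (fromℕ k)) ⊛ G) ≈⟨ ⊛-congˡ (taylor (prodExcept n k)) (≈-trans (⊛-congʳ G (taylor-plin-X (fromℕ k)))
                                                                  (invLinear-inverse (fromℕ-sub-≢0 k≢j))) ⟩
    taylor (prodExcept n k) ⊛ 𝟙                           ≈⟨ ⊛-comm _ 𝟙 ⟩
    𝟙 ⊛ taylor (prodExcept n k)                           ≈⟨ 𝟙-⊛ _ ⟩
    taylor (prodExcept n k)                               ∎
    where
    open ≈-Reasoning
    G : Series
    G = invLinear (fromℕ k + t₀)
    X≈ : X ≈ taylor (plin (fromℕ j))
    X≈ = ≈-sym (≈-trans (taylor-plin-X (fromℕ j))
                 (≈-trans (⊕-congʳ X (≈-trans (const-cong (+-inverseʳ (fromℕ j))) (≈-sym 𝟘≈const0))) (𝟘-⊕ X)))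

  dlcm-multiple : ∀ {k} → k ≤ n → ¬ k ≡ j → Σ ℚ λ q → IsInt q × fromℕ d ≡ q * (fromℕ k + t₀)
  dlcm-multiple {k} k≤n k≢j with ℕ.<-cmp k j
  ... | tri≈ _ k≡j _ = contradiction k≡j k≢j
  ... | tri< k<j _ _ with divides y d≡y*[j-k] ← ∣dlcm (ℕ.m<n⇒0<n∸m k<j) (ℕ.≤-trans (ℕ.m∸n≤m j k) j≤n) =
    - fromℕ y , IsInt-neg (IsInt-fromℕ y) , (begin
      fromℕ d                        ≡⟨ cong fromℕ d≡y*[j-k] ⟩
      fromℕ (y ℕ.* (j ∸ k))          ≡⟨ fromℕ-homo-* y (j ∸ k) ⟩
      fromℕ y * fromℕ (j ∸ k)        ≡⟨ solve 2 (λ a b → a :* b := :- a :* :- b) refl (fromℕ y) (fromℕ (j ∸ k)) ⟩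
      - fromℕ y * - fromℕ (j ∸ k)    ≡⟨ cong (- fromℕ y *_) (fromℕ-∸ˡ (ℕ.<⇒≤ k<j)) ⟨
      - fromℕ y * (fromℕ k + t₀)     ∎)
    where
    open ≡-Reasoning
    open +-*-Solver
  ... | tri> _ _ j<k with divides y d≡y*[k-j] ← ∣dlcm (ℕ.m<n⇒0<n∸m j<k) (ℕ.≤-trans (ℕ.m∸n≤m k j) k≤n) =
    fromℕ y , IsInt-fromℕ y , (begin
      fromℕ d                        ≡⟨ cong fromℕ d≡y*[k-j] ⟩
      fromℕ (y ℕ.* (k ∸ j))          ≡⟨ fromℕ-homo-* y (k ∸ j) ⟩
      fromℕ y * fromℕ (k ∸ j)        ≡⟨ cong (fromℕ y *_) (fromℕ-∸ (ℕ.<⇒≤ j<k)) ⟨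
      fromℕ y * (fromℕ k + t₀)       ∎)
    where open ≡-Reasoning

  DIntegral-H : ∀ {k} → k ≤ n → DIntegral d (H k)
  DIntegral-H {k} k≤n with k ℕ.≟ j
  ... | yes _   = DIntegral-𝟙
  ... | no k≢j with q , q-int , d≡q[k-j] ← dlcm-multiple k≤n k≢j = DIntegral-X·invLinear (fromℕ-sub-≢0 k≢j) q-int d≡q[k-j]

  -- P / Q = ∑ₖ wₖ (t + j)/(t + k), with wₖ the Lagrange weights of P at the nodes 0, -1, …, -n.
  ratio : Poly → Series
  ratio P = ∑[ k < suc n ] (const (lagrangeWeight n P k) ⊛ H k)

  Q⊛ratio : ∀ P → length P ≤ suc n → Q ⊛ ratio P ≈ taylor P
  Q⊛ratio P |P| = begin
    Q ⊛ ratio P                                                      ≈⟨ ⊛-∑ Q _ (suc n) ⟩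
    ∑[ k < suc n ] (Q ⊛ (const (lagrangeWeight n P k) ⊛ H k))        ≈⟨ ∑-cong (suc n) (λ k k<1+n → ≈-trans (swap (const (lagrangeWeight n P k)) (H k))
                                                                          (⊛-congˡ (const (lagrangeWeight n P k)) (Q⊛H≈prodExcept (ℕ.≤-pred k<1+n)))) ⟩
    ∑[ k < suc n ] (const (lagrangeWeight n P k) ⊛ taylor (prodExcept n k)) ≈⟨ lagrange n P |P| t₀ ⟨
    taylor P                                                         ∎
    where
    open ≈-Reasoning
    swap : ∀ a h → Q ⊛ (a ⊛ h) ≈ a ⊛ (Q ⊛ h)
    swap a h = solve 3 (λ q a h → q :* (a :* h) := a :* (q :* h)) ≈-refl Q a h
      where open ⊛-Solver

  DIntegral-ratio : ∀ P → (∀ {k} → k ≤ n → IsInt (lagrangeWeight n P k)) → DIntegral d (ratio P)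
  DIntegral-ratio P weight-int = DIntegral-∑ (suc n) (λ k k<1+n →
    DIntegral-⊛ (DIntegral-const (weight-int (ℕ.≤-pred k<1+n))) (DIntegral-H (ℕ.≤-pred k<1+n)))

module Denominator where

  open import Data.Nat as ℕ using (ℕ; zero; suc)
  open import Data.Rational using (1ℚ)
  open import Data.List using (map; applyUpTo)
  import Data.List.Properties as List
  open import Data.Product using (Σ; _,_; proj₁; proj₂)
  open import Relation.Nullary using (¬_; yes; no; contradiction)
  open import Relation.Binary.PropositionalEquality
  open import Defs

  denominatorFactor : ℕ → ℕ → ℕ → Poly
  denominatorFactor a j i with i ℕ.≟ j
  ... | yes _ = pconst 1ℚ
  ... | no  _ = ppow (plin (fromℕ i)) a

  private
    -- The factors of the denominator are local to `RtimesPow`; the first one reduces once j is split.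
    local-factors : ∀ a n j → Σ (ℕ → Poly) λ F → RatFun.den (RtimesPow a n j) ≡ pmul (denominatorFactor a j 0) (pprod (map F (applyUpTo suc n)))
    local-factors a n zero    = _ , refl
    local-factors a n (suc j) = _ , refl

    local-factors-≗ : ∀ a n j i → proj₁ (local-factors a n j) i ≡ denominatorFactor a j i
    local-factors-≗ a n zero i with i ℕ.≟ zero
    ... | yes _ = refl
    ... | no  _ = refl
    local-factors-≗ a n (suc j) i with i ℕ.≟ suc j
    ... | yes _ = refl
    ... | no  _ = refl

  den-RtimesPow : ∀ a n j → RatFun.den (RtimesPow a n j) ≡ pprod (map (denominatorFactor a j) (range0 n))
  den-RtimesPow a n j = trans (proj₂ (local-factors a n j))
    (cong (λ Fs → pmul (denominatorFactor a j 0) (pprod Fs)) (List.map-cong (local-factors-≗ a n j) (applyUpTo suc n)))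

  denominatorFactor-≡ : ∀ a j → denominatorFactor a j j ≡ pconst 1ℚ
  denominatorFactor-≡ a j with j ℕ.≟ j
  ... | yes _   = refl
  ... | no  j≢j = contradiction refl j≢j

  denominatorFactor-≢ : ∀ a {i j} → ¬ i ≡ j → denominatorFactor a j i ≡ ppow (plin (fromℕ i)) a
  denominatorFactor-≢ a {i} {j} i≢j with i ℕ.≟ j
  ... | yes i≡j = contradiction i≡j i≢j
  ... | no  _   = refl

module Coefficients (a n j : ℕ) (j≤n : j ≤ n) (6≤a : 6 ≤ a) where

  open import Data.Nat as ℕ using (zero; suc; _<_; _∸_; _!; _^_)
  import Data.Nat.Properties as ℕ
  open import Data.Integer using (+_)
  open import Data.Rational using (0ℚ; 1ℚ; _+_; _*_; -_; _/_)
  open import Data.Rational.Properties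
  open import Data.Rational.Solver using (module +-*-Solver)
  open import Data.List using (map)
  open import Relation.Nullary using (¬_)
  open import Relation.Binary.PropositionalEquality
  open import Function using (_∘_)
  open import Defs
  open Rationals
  open PowerSeries
  open IntegralSeries
  open Interpolation
  open LagrangeWeights
  open QuotientRule
  open ExpansionAtNode n j j≤n
  open Denominator

  taylor-den : taylor (RatFun.den (RtimesPow a n j)) ≈ Q ^ₛ a
  taylor-den = begin
    taylor (RatFun.den (RtimesPow a n j))
      ≡⟨ cong taylor (den-RtimesPow a n j) ⟩
    taylor (pprod (map F (range0 n)))
      ≈⟨ taylor-pprod F (λ i → i) (suc n) ⟩
    ∏< (suc n) TF
      ≡⟨ cong (λ m → ∏< m TF) (trans (ℕ.+-suc j (n ∸ j)) (cong suc (ℕ.m+[n∸m]≡n j≤n))) ⟨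
    ∏< (j ℕ.+ suc (n ∸ j)) TF
      ≈⟨ ≈-trans (∏-+ TF j (suc (n ∸ j))) (⊛-congˡ (∏< j TF) (∏-suc (λ l → TF (j ℕ.+ l)) (n ∸ j))) ⟩
    ∏< j TF ⊛ (TF (j ℕ.+ 0) ⊛ ∏[ l < n ∸ j ] TF (j ℕ.+ suc l))
      ≈⟨ ⊛-cong (∏-cong j below) (⊛-cong at-j (∏-cong (n ∸ j) above)) ⟩
    ∏[ l < j ] (L l ^ₛ a) ⊛ (𝟙 ⊛ ∏[ l < n ∸ j ] (R l ^ₛ a))
      ≈⟨ ⊛-cong (∏-^ L a j) (≈-trans (𝟙-⊛ _) (∏-^ R a (n ∸ j))) ⟩
    ∏< j L ^ₛ a ⊛ ∏< (n ∸ j) R ^ₛ a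
      ≈⟨ ^-distrib-* (∏< j L) (∏< (n ∸ j) R) a ⟨
    (∏< j L ⊛ ∏< (n ∸ j) R) ^ₛ a
      ≈⟨ ^-congˡ a (≈-trans (taylor-pmul (poch 0ℚ j) _) (⊛-cong (taylor-poch t₀ 0ℚ j) (taylor-poch t₀ (fromℕ (suc j)) (n ∸ j)))) ⟨
    Q ^ₛ a ∎
    where
    open ≈-Reasoning
    F : ℕ → Poly
    F = denominatorFactor a j
    TF : ℕ → Series
    TF = λ i → taylor (F i)
    L : ℕ → Series
    L = λ l → taylor (plin (0ℚ + fromℕ l))
    R : ℕ → Series
    R = λ l → taylor (plin (fromℕ (suc j) + fromℕ l))
    factor≢j : ∀ {i c} → ¬ i ≡ j → fromℕ i ≡ c → TF i ≈ taylor (plin c) ^ₛ a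
    factor≢j {i} i≢j refl rewrite denominatorFactor-≢ a i≢j = taylor-ppow (plin (fromℕ i)) a
    below : ∀ l → l < j → TF l ≈ L l ^ₛ a
    below l l<j = factor≢j (ℕ.<⇒≢ l<j) (sym (+-identityˡ (fromℕ l)))
    above : ∀ l → l < n ∸ j → TF (j ℕ.+ suc l) ≈ R l ^ₛ a
    above l _ = factor≢j (ℕ.m+1+n≢m j) (trans (cong fromℕ (ℕ.+-suc j l)) (fromℕ-homo-+ (suc j) l))
    at-j : TF (j ℕ.+ 0) ≈ 𝟙
    at-j rewrite ℕ.+-identityʳ j | denominatorFactor-≡ a j = taylor-pconst 1ℚ

  P₁ P₂ P₃ : Poly
  P₁ = poch (- fromℕ n) n
  P₂ = poch (fromℕ (suc n)) n
  P₃ = pconst (fromℕ (n !))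

  L : Series
  L = taylor (plin ((+ n) / 2))

  -- The expansion of R_n(t)(t+j)^a, whose factor n!^{a-6} is absorbed into (P₃/Q)^{a-6}.
  g : Series
  g = L ⊛ (ratio P₁ ^ₛ 3 ⊛ ratio P₂ ^ₛ 3) ⊛ ratio P₃ ^ₛ (a ∸ 6)

  Q^a⊛g≈num : Q ^ₛ a ⊛ g ≈ taylor (RatFun.num (RtimesPow a n j))
  Q^a⊛g≈num = begin
    Q ^ₛ a ⊛ g
      ≈⟨ ⊛-congʳ g (≈-trans (^-congʳ Q a≡) (≈-trans (^-homo-* Q 3 (3 ℕ.+ e)) (⊛-congˡ (Q ^ₛ 3) (^-homo-* Q 3 e)))) ⟩
    Q ^ₛ 3 ⊛ (Q ^ₛ 3 ⊛ Q ^ₛ e) ⊛ (L ⊛ (U₁ ^ₛ 3 ⊛ U₂ ^ₛ 3) ⊛ U₃ ^ₛ e)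
      ≈⟨ solve 7 (λ A B C l u₁ u₂ u₃ → A :* (B :* C) :* (l :* (u₁ :* u₂) :* u₃) := (C :* u₃) :* (l :* ((A :* u₁) :* (B :* u₂))))
           ≈-refl (Q ^ₛ 3) (Q ^ₛ 3) (Q ^ₛ e) L (U₁ ^ₛ 3) (U₂ ^ₛ 3) (U₃ ^ₛ e) ⟩
    (Q ^ₛ e ⊛ U₃ ^ₛ e) ⊛ (L ⊛ ((Q ^ₛ 3 ⊛ U₁ ^ₛ 3) ⊛ (Q ^ₛ 3 ⊛ U₂ ^ₛ 3)))
      ≈⟨ ⊛-cong (^-distrib-* Q U₃ e) (⊛-congˡ L (⊛-cong (^-distrib-* Q U₁ 3) (^-distrib-* Q U₂ 3))) ⟨
    (Q ⊛ U₃) ^ₛ e ⊛ (L ⊛ ((Q ⊛ U₁) ^ₛ 3 ⊛ (Q ⊛ U₂) ^ₛ 3))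
      ≈⟨ ⊛-cong (^-congˡ e (Q⊛ratio P₃ (ℕ.s≤s ℕ.z≤n)))
                (⊛-congˡ L (⊛-cong (^-congˡ 3 (Q⊛ratio P₁ (length-poch _ n))) (^-congˡ 3 (Q⊛ratio P₂ (length-poch _ n))))) ⟩
    taylor P₃ ^ₛ e ⊛ (L ⊛ (taylor P₁ ^ₛ 3 ⊛ taylor P₂ ^ₛ 3))
      ≈⟨ ⊛-congʳ (L ⊛ (taylor P₁ ^ₛ 3 ⊛ taylor P₂ ^ₛ 3)) (≈-trans (^-congˡ e (taylor-pconst (fromℕ (n !)))) (const-^ (n !) e)) ⟩
    const (fromℕ ((n !) ^ e)) ⊛ (L ⊛ (taylor P₁ ^ₛ 3 ⊛ taylor P₂ ^ₛ 3))
      ≈⟨ ⊛-congˡ (const (fromℕ ((n !) ^ e)))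
           (⊛-congˡ L (≈-trans (taylor-pmul (ppow P₁ 3) (ppow P₂ 3)) (⊛-cong (taylor-ppow P₁ 3) (taylor-ppow P₂ 3)))) ⟨
    const (fromℕ ((n !) ^ e)) ⊛ (L ⊛ taylor (pmul (ppow P₁ 3) (ppow P₂ 3)))
      ≈⟨ ≈-trans (taylor-pscale (fromℕ ((n !) ^ e)) (pmul h P₁³P₂³)) (⊛-congˡ (const (fromℕ ((n !) ^ e))) (taylor-pmul h P₁³P₂³)) ⟨
    taylor (RatFun.num (RtimesPow a n j)) ∎
    where
    open ≈-Reasoning
    open ⊛-Solver
    e : ℕ
    e = a ∸ 6
    U₁ : Series
    U₁ = ratio P₁
    U₂ : Series
    U₂ = ratio P₂
    U₃ : Series
    U₃ = ratio P₃
    h : Poly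
    h = plin ((+ n) / 2)
    P₁³P₂³ : Poly
    P₁³P₂³ = pmul (ppow P₁ 3) (ppow P₂ 3)
    a≡ : a ≡ 3 ℕ.+ (3 ℕ.+ e)
    a≡ = sym (ℕ.m+[n∸m]≡n 6≤a)

  c≡g : ∀ l → c a l j n ≡ g (a ∸ l)
  c≡g l = Dλat-expansion t₀ (a ∸ l) _ _ g den≢0 (≈-trans (⊛-congʳ g taylor-den) Q^a⊛g≈num)
    where
    Q^k≢0 : ∀ k → ¬ (Q ^ₛ k) 0 ≡ 0ℚ
    Q^k≢0 zero    = 1≢0
    Q^k≢0 (suc k) = p*q≢0 (peval-prodExcept-≢0 n j ∘ trans (sym (taylor-0 (prodExcept n j)))) (Q^k≢0 k)
    den≢0 : ¬ peval (RatFun.den (RtimesPow a n j)) t₀ ≡ 0ℚ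
    den≢0 = Q^k≢0 a ∘ trans (sym (taylor-den 0)) ∘ trans (taylor-0 (RatFun.den (RtimesPow a n j)))

  DIntegral-2L : DIntegral d (fromℕ 2 · L)
  DIntegral-2L = DIntegral-cong (≈-sym 2L≈) (DIntegral-⊕ (DIntegral-const 2[n/2-j]-int) (DIntegral-· (IsInt-fromℕ 2) DIntegral-X))
    where
    open +-*-Solver
    2L≈ : fromℕ 2 · L ≈ const (fromℕ 2 * ((+ n) / 2 + t₀)) ⊕ fromℕ 2 · X
    2L≈ zero    = trans (cong (fromℕ 2 *_) (taylor-plin-X ((+ n) / 2) 0)) (*-distribˡ-+ (fromℕ 2) ((+ n) / 2 + t₀) (X 0))
    2L≈ (suc k) = trans (cong (fromℕ 2 *_) (taylor-plin-X ((+ n) / 2) (suc k)))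
                        (solve 2 (λ w x → w :* (con 0ℚ :+ x) := con 0ℚ :+ w :* x) refl (fromℕ 2) (X (suc k)))
    2[n/2-j]-int : IsInt (fromℕ 2 * ((+ n) / 2 + t₀))
    2[n/2-j]-int = subst IsInt (sym (trans (*-distribˡ-+ (fromℕ 2) ((+ n) / 2) t₀) (cong (_+ fromℕ 2 * t₀) (2*[z/2]≡z (+ n)))))
                     (IsInt-+ (IsInt-fromℕ n) (IsInt-* (IsInt-fromℕ 2) (IsInt-neg (IsInt-fromℕ j))))

  DIntegral-2g : DIntegral d (fromℕ 2 · g)
  DIntegral-2g = DIntegral-cong 2g≈ (DIntegral-⊛ (DIntegral-⊛ DIntegral-2L (DIntegral-⊛ (DIntegral-^ₛ 3 U₁-int) (DIntegral-^ₛ 3 U₂-int)))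
                                                (DIntegral-^ₛ (a ∸ 6) U₃-int))
    where
    U₁-int : DIntegral d (ratio P₁)
    U₁-int = DIntegral-ratio P₁ IsInt-lagrangeWeight-poch-n
    U₂-int : DIntegral d (ratio P₂)
    U₂-int = DIntegral-ratio P₂ IsInt-lagrangeWeight-poch-n+1
    U₃-int : DIntegral d (ratio P₃)
    U₃-int = DIntegral-ratio P₃ IsInt-lagrangeWeight-n!
    2g≈ : fromℕ 2 · L ⊛ (ratio P₁ ^ₛ 3 ⊛ ratio P₂ ^ₛ 3) ⊛ ratio P₃ ^ₛ (a ∸ 6) ≈ fromℕ 2 · g
    2g≈ = ≈-trans (⊛-congʳ (ratio P₃ ^ₛ (a ∸ 6)) (·-⊛ (fromℕ 2) L _)) (·-⊛ (fromℕ 2) (L ⊛ _) _)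

  IsInt-2dᵃ⁻ˡc : ∀ l → IsInt (fromℕ (2 ℕ.* d ^ (a ∸ l)) * c a l j n)
  IsInt-2dᵃ⁻ˡc l = subst IsInt (begin
    fromℕ (d ^ m) * (fromℕ 2 * g m) ≡⟨ solve 3 (λ x y z → x :* (y :* z) := y :* x :* z) refl (fromℕ (d ^ m)) (fromℕ 2) (g m) ⟩
    fromℕ 2 * fromℕ (d ^ m) * g m   ≡⟨ cong₂ _*_ (fromℕ-homo-* 2 (d ^ m)) (c≡g l) ⟨
    fromℕ (2 ℕ.* d ^ m) * c a l j n ∎) (DIntegral-2g m)
    where
    open ≡-Reasoning
    open +-*-Solver
    m : ℕ
    m = a ∸ l

module IntegerPolynomials where

  open import Data.Nat as ℕ using (ℕ; zero; suc; _≤_; s≤s; z≤n)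
  import Data.Nat.Properties as ℕ
  open import Data.Rational using (_*_)
  open import Data.Rational.Properties using (*-zeroʳ; *-distribˡ-+; *-comm; *-assoc)
  open import Data.List using (List; []; _∷_; foldr; concatMap)
  open import Data.List.Relation.Unary.All as All using (All; []; _∷_)
  import Data.List.Relation.Unary.All.Properties as All
  open import Relation.Binary.PropositionalEquality
  open import Defs hiding (c)
  open Rationals

  All-range0 : ∀ {P : ℕ → Set} n → (∀ {j} → j ≤ n → P j) → All P (range0 n)
  All-range0 n P-holds = All.applyUpTo⁺₁ (λ x → x) (suc n) (λ j<1+n → P-holds (ℕ.≤-pred j<1+n))

  All-range1 : ∀ {P : ℕ → Set} n → (∀ {j} → 1 ≤ j → j ≤ n → P j) → All P (range1 n)
  All-range1 n P-holds = All.map⁺ (All.applyUpTo⁺₁ (λ x → x) n (λ j<n → P-holds (s≤s z≤n) j<n))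

  InZ[z]-padd : ∀ p q → InZ[z] p → InZ[z] q → InZ[z] (padd p q)
  InZ[z]-padd []      q       _           q-int       = q-int
  InZ[z]-padd (x ∷ p) []      p-int       _           = p-int
  InZ[z]-padd (x ∷ p) (y ∷ q) (x∈ℤ ∷ p∈ℤ) (y∈ℤ ∷ q∈ℤ) = IsInt-+ x∈ℤ y∈ℤ ∷ InZ[z]-padd p q p∈ℤ q∈ℤ

  pscale-padd : ∀ c p q → pscale c (padd p q) ≡ padd (pscale c p) (pscale c q)
  pscale-padd c []      q       = refl
  pscale-padd c (x ∷ p) []      = refl
  pscale-padd c (x ∷ p) (y ∷ q) = cong₂ _∷_ (*-distribˡ-+ c x y) (pscale-padd c p q)

  InZ[z]-pscale-sum : ∀ s ps → All (λ p → InZ[z] (pscale s p)) ps → InZ[z] (pscale s (foldr padd [] ps))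
  InZ[z]-pscale-sum s []       []             = []
  InZ[z]-pscale-sum s (p ∷ ps) (sp-int ∷ sps-int) rewrite pscale-padd s p (foldr padd [] ps) =
    InZ[z]-padd (pscale s p) _ sp-int (InZ[z]-pscale-sum s ps sps-int)

  InZ[z]-pscale-pscale : ∀ {s c} p → IsInt c → InZ[z] (pscale s p) → InZ[z] (pscale s (pscale c p))
  InZ[z]-pscale-pscale {s} {c} []      _     _                 = []
  InZ[z]-pscale-pscale {s} {c} (x ∷ p) c-int (sx-int ∷ sp-int) =
    subst IsInt (trans (*-comm c (s * x)) (trans (*-assoc s x c) (cong (s *_) (*-comm x c)))) (IsInt-* c-int sx-int)
    ∷ InZ[z]-pscale-pscale {s} p c-int sp-int

  InZ[z]-pscale-pmonomial : ∀ s {x} e → IsInt (s * x) → InZ[z] (pscale s (pmonomial x e))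
  InZ[z]-pscale-pmonomial s zero    sx-int = sx-int ∷ []
  InZ[z]-pscale-pmonomial s (suc e) sx-int = subst IsInt (sym (*-zeroʳ s)) (IsInt-fromℕ 0) ∷ InZ[z]-pscale-pmonomial s e sx-int

  All-concatMap : ∀ {A B : Set} {P : B → Set} (f : A → List B) {xs} → All (λ x → All P (f x)) xs → All P (concatMap f xs)
  All-concatMap f all = All.concat⁺ (All.map⁺ all)

module P0Coefficients where

  open import Data.Nat as ℕ using (ℕ; zero; suc; _≤_; _∸_; _^_)
  import Data.Nat.Properties as ℕ
  open import Data.Nat.Divisibility using (_∣_; divides; m∣m*n; ∣m∣n⇒∣m+n)
  open import Data.Nat.Solver using (module +-*-Solver)
  open import Data.Rational using (ℚ; 0ℚ; _*_)
  open import Data.Rational.Properties using (*-assoc)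
  import Data.Rational.Solver as ℚ-Solver
  open import Relation.Nullary using (¬_)
  open import Relation.Binary.PropositionalEquality
  open import Function using (_∘_)
  open import Defs
  open Rationals
  open LeastCommonMultiple

  2∣m*[1+m] : ∀ m → 2 ∣ m ℕ.* suc m
  2∣m*[1+m] zero    = divides 0 refl
  2∣m*[1+m] (suc m) = subst (2 ∣_) (solve 1 (λ x → x :* (con 1 :+ x) :+ con 2 :* (con 1 :+ x) := (con 1 :+ x) :* (con 2 :+ x)) refl m)
    (∣m∣n⇒∣m+n (2∣m*[1+m] m) (m∣m*n (suc m)))
    where open +-*-Solver

  ^-distribʳ-* : ∀ m n p → (m ℕ.* n) ^ p ≡ m ^ p ℕ.* n ^ p
  ^-distribʳ-* m n zero    = refl
  ^-distribʳ-* m n (suc p) = trans (cong (m ℕ.* n ℕ.*_) (^-distribʳ-* m n p))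
    (solve 4 (λ a b c e → (a :* b) :* (c :* e) := (a :* c) :* (b :* e)) refl m n (m ^ p) (n ^ p))
    where open +-*-Solver

  private
    scaling-identity : ∀ {a l d} k q t → l ≤ a → d ≡ q ℕ.* k → l ℕ.* suc l ≡ t ℕ.* 2 →
      2 ℕ.* d ^ (a ℕ.+ 2) ℕ.* (l ℕ.* suc l) ≡ 2 ℕ.* k ^ (l ℕ.+ 2) ℕ.* (2 ℕ.* d ^ (a ∸ l) ℕ.* (t ℕ.* q ^ (l ℕ.+ 2)))
    scaling-identity {a} {l} {d} k q t l≤a refl l[1+l]≡2t = begin
      2 ℕ.* d ^ (a ℕ.+ 2) ℕ.* (l ℕ.* suc l)
        ≡⟨ cong₂ (λ e u → 2 ℕ.* d ^ e ℕ.* u) a+2≡ l[1+l]≡2t ⟩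
      2 ℕ.* d ^ ((a ∸ l) ℕ.+ (l ℕ.+ 2)) ℕ.* (t ℕ.* 2)
        ≡⟨ cong (λ u → 2 ℕ.* u ℕ.* (t ℕ.* 2)) (ℕ.^-distribˡ-+-* d (a ∸ l) (l ℕ.+ 2)) ⟩
      2 ℕ.* (d ^ (a ∸ l) ℕ.* d ^ (l ℕ.+ 2)) ℕ.* (t ℕ.* 2)
        ≡⟨ cong (λ u → 2 ℕ.* (d ^ (a ∸ l) ℕ.* u) ℕ.* (t ℕ.* 2)) (^-distribʳ-* q k (l ℕ.+ 2)) ⟩
      2 ℕ.* (d ^ (a ∸ l) ℕ.* (q ^ (l ℕ.+ 2) ℕ.* k ^ (l ℕ.+ 2))) ℕ.* (t ℕ.* 2)
        ≡⟨ solve 4 (λ D Q K T → con 2 :* (D :* (Q :* K)) :* (T :* con 2) := con 2 :* K :* (con 2 :* D :* (T :* Q)))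
             refl (d ^ (a ∸ l)) (q ^ (l ℕ.+ 2)) (k ^ (l ℕ.+ 2)) t ⟩
      2 ℕ.* k ^ (l ℕ.+ 2) ℕ.* (2 ℕ.* d ^ (a ∸ l) ℕ.* (t ℕ.* q ^ (l ℕ.+ 2))) ∎
      where
      open ≡-Reasoning
      open +-*-Solver
      a+2≡ : a ℕ.+ 2 ≡ (a ∸ l) ℕ.+ (l ℕ.+ 2)
      a+2≡ = trans (cong (ℕ._+ 2) (sym (ℕ.m∸n+n≡m l≤a))) (ℕ.+-assoc (a ∸ l) l 2)

  -- 2 d^{a+2} · l(l+1) c / (2 k^{l+2}) = (2 d^{a-l} c) · (l(l+1)/2) · (d/k)^{l+2}, with k ∣ d.
  IsInt-P₀-coefficient : ∀ {a n l j k} → 6 ≤ a → l ≤ a → j ≤ n → 1 ≤ k → k ≤ n →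
    IsInt (fromℕ (2 ℕ.* dlcm n ^ (a ℕ.+ 2)) * ((fromℕ (l ℕ.* suc l) * c a l j n) ÷' (fromℕ 2 * (fromℕ k ^ℚ (l ℕ.+ 2)))))
  IsInt-P₀-coefficient {a} {n} {l} {j} {k} 6≤a l≤a j≤n 1≤k k≤n
    with divides q d≡q*k ← ∣dlcm 1≤k k≤n | divides t l[1+l]≡t*2 ← 2∣m*[1+m] l =
    IsInt-*÷' {s} {x} den≢0 eq (IsInt-* (Coefficients.IsInt-2dᵃ⁻ˡc a n j j≤n 6≤a l) (IsInt-fromℕ w))
    where
    open ≡-Reasoning
    open ℚ-Solver.+-*-Solver
    d : ℕ
    d = dlcm n
    w : ℕ
    w = t ℕ.* q ^ (l ℕ.+ 2)
    s : ℚ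
    s = fromℕ (2 ℕ.* d ^ (a ℕ.+ 2))
    x : ℚ
    x = fromℕ (l ℕ.* suc l) * c a l j n
    kˡ⁺² : ℚ
    kˡ⁺² = fromℕ k ^ℚ (l ℕ.+ 2)
    e : ℚ
    e = fromℕ (2 ℕ.* d ^ (a ∸ l))
    kˡ⁺²≢0 : ¬ kˡ⁺² ≡ 0ℚ
    kˡ⁺²≢0 = fromℕ-≢0 (ℕ.<⇒≢ (ℕ.m^n>0 k {{ℕ.>-nonZero 1≤k}} (l ℕ.+ 2)) ∘ sym) ∘ trans (sym (fromℕ-^ℚ k (l ℕ.+ 2)))
    den≢0 : ¬ fromℕ 2 * kˡ⁺² ≡ 0ℚ
    den≢0 = p*q≢0 {fromℕ 2} {kˡ⁺²} (fromℕ-≢0 {2} λ ()) kˡ⁺²≢0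
    eq : s * x ≡ fromℕ 2 * kˡ⁺² * (e * c a l j n * fromℕ w)
    eq = begin
      s * (fromℕ (l ℕ.* suc l) * c a l j n)
        ≡⟨ *-assoc s (fromℕ (l ℕ.* suc l)) (c a l j n) ⟨
      s * fromℕ (l ℕ.* suc l) * c a l j n
        ≡⟨ cong (_* c a l j n) (trans (sym (fromℕ-homo-* (2 ℕ.* d ^ (a ℕ.+ 2)) (l ℕ.* suc l)))
                                      (cong fromℕ (scaling-identity k q t l≤a d≡q*k l[1+l]≡t*2))) ⟩
      fromℕ (2 ℕ.* k ^ (l ℕ.+ 2) ℕ.* (2 ℕ.* d ^ (a ∸ l) ℕ.* w)) * c a l j n
        ≡⟨ cong (_* c a l j n) (trans (fromℕ-homo-* (2 ℕ.* k ^ (l ℕ.+ 2)) (2 ℕ.* d ^ (a ∸ l) ℕ.* w))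
                                     (cong₂ _*_ (trans (fromℕ-homo-* 2 (k ^ (l ℕ.+ 2))) (cong (fromℕ 2 *_) (sym (fromℕ-^ℚ k (l ℕ.+ 2)))))
                                                (fromℕ-homo-* (2 ℕ.* d ^ (a ∸ l)) w))) ⟩
      fromℕ 2 * kˡ⁺² * (e * fromℕ w) * c a l j n
        ≡⟨ solve 4 (λ D A B C → D :* (A :* B) :* C := D :* (A :* C :* B)) refl (fromℕ 2 * kˡ⁺²) e (fromℕ w) (c a l j n) ⟩
      fromℕ 2 * kˡ⁺² * (e * c a l j n * fromℕ w) ∎

open import Defs
open import Data.Nat using (ℕ; _≤_; _+_; _*_; _∸_; _^_)
open import Data.Product using (_×_; _,_)
import Data.Nat.Properties as ℕ
import Data.List.Relation.Unary.All.Properties as All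
open Rationals using (IsInt-neg; IsInt-fromℕ)
open IntegerPolynomials
open Coefficients using (IsInt-2dᵃ⁻ˡc)
open P0Coefficients using (IsInt-P₀-coefficient)

mainTheorem3 : (a n : ℕ) → 6 ≤ a → 1 ≤ n →
    ((l : ℕ) → 1 ≤ l → l ≤ a →
    InZ[z] (pscale (fromℕ (2 * dlcm n ^ (a ∸ l))) (Pl a l n)))
    × InZ[z] (pscale (fromℕ (2 * dlcm n ^ (a + 2))) (P0 a n))
mainTheorem3 a n 6≤a _ = Pl-integral , P0-integral
  where
  s : ℚ
  s = fromℕ (2 * dlcm n ^ (a + 2))
  Pl-integral : (l : ℕ) → 1 ≤ l → l ≤ a → InZ[z] (pscale (fromℕ (2 * dlcm n ^ (a ∸ l))) (Pl a l n))
  Pl-integral l _ _ = All.map⁺ (All.map⁺ (All-range0 n (λ j≤n → IsInt-2dᵃ⁻ˡc a n _ j≤n 6≤a l)))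
  P0-integral : InZ[z] (pscale (fromℕ (2 * dlcm n ^ (a + 2))) (P0 a n))
  P0-integral = InZ[z]-pscale-pscale {s} _ (IsInt-neg (IsInt-fromℕ 1)) (InZ[z]-pscale-sum s _
    (All-concatMap _ (All-range1 a λ _ l≤a →
     All-concatMap _ (All-range1 n λ _ j≤n →
     All.map⁺ (All-range1 _ λ 1≤k k≤j →
     InZ[z]-pscale-pmonomial s _ (IsInt-P₀-coefficient 6≤a l≤a j≤n 1≤k (ℕ.≤-trans k≤j j≤n)))))))
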